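{- Let $m\ge2$, $n\ge1$, let $G$ be a finite Abelian group and $(s_1,\dots,s_n)\in G^n$ with $G\ge[-m+1,m]^*\diamond_2 (s_1,\dots,s_n)$. Let $M_2$ be the number of equations $s_i-s_j=s_k-s_l$ with $(i,j),(k,l)\in\Delta$, $(i,j)\ne(k,l)$, $i\equiv l\pmod n$ and $k\equiv j\pmod n$, where an equation and the one obtained by exchanging its two sides (i.e. the unordered pair $\{(i,j),(k,l)\}$) are counted once. Let $C=|\{i\in[1,n]: 2ms_i=0\}|$. (1) If $m_{2m}(G)>0$, then $$M_2\le \left(2m^2-4m+\tfrac{5}{2}\right)n^2+\left(4m-\tfrac{9}{2}\right)n+C^2+(2mn-3n-2m^2-2m+6)C+(2m-3)m_2(G).$$ (2) If $m_{2m}(G)=0$, then $$M_2\le (2m^2-4m+2)n^2+(4m-4)n+(2m-3)m_2(G).$$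
   Context: $[a,b]=\{a,\dots,b\}$, $[a,b]^*=[a,b]\setminus\{0\}$. For a finite Abelian group $G$, finite $M\subseteq\mathbb{Z}\setminus\{0\}$ and $S=(s_1,\dots,s_n)\in G^n$, $G\ge M\diamond_t S$ means the elements $\sum_i e_is_i$, for $\mathbf{e}\in(M\cup\{0\})^n$ with $1\le\mathrm{wt}(\mathbf{e})\le t$ (Hamming weight), are nonzero and pairwise distinct for distinct $\mathbf{e}$. For $l\ge2$, $m_l(G)$ is the number of elements of $G$ of order exactly $l$. Extend the indexing: for $i\in[1,n]$ and $1\le k\le m-1$ put $s_{i+kn}=(k+1)s_i$ and $s_{i-kn}=-ks_i$, and $s_\infty=0$. Let $J=[1-n(m-1),nm]\cup\{\infty\}$; congruence mod $n$ among integer indices is the usual one, $\infty\equiv\infty$, and $\infty$ is not congruent to any integer index. $\Delta=\{(i,j)\in J^2: i\not\equiv j\pmod n\}$. -}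

module Defs where

open import Level using (Level; _⊔_) renaming (suc to lsuc)
open import Algebra.Bundles using (AbelianGroup)
open import Data.Nat as ℕ using (ℕ; zero; suc; _≤_; _≤?_)
import Data.Nat.Divisibility as ℕD
open import Data.Integer as ℤ using (ℤ; +_; -[1+_])
open import Data.Integer.DivMod using (_%ℕ_; _/ℕ_; n%ℕd<d)
open import Data.Integer.Divisibility using (_∣_)
open import Data.Fin as Fin using (Fin; toℕ; fromℕ<)
open import Data.Fin.Properties using (all?)
open import Data.List as List using (List; []; _∷_; map; cartesianProduct; _++_)
open import Data.Product using (Σ; ∃; _×_; _,_; proj₁; proj₂)
open import Data.Bool using (Bool; true; false)
open import Relation.Nullary using (¬_; Dec; yes; no)
open import Relation.Nullary.Decidable using (_×-dec_; ¬?; _→-dec_)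
open import Relation.Binary.PropositionalEquality using (_≡_; _≢_)
import Data.Unit
import Data.Empty

countL : ∀ {a p} {A : Set a} (P : A → Set p) → (∀ x → Dec (P x)) → List A → ℕ
countL P P? [] = 0
countL P P? (x ∷ xs) with P? x
... | yes _ = suc (countL P P? xs)
... | no  _ = countL P P? xs

countFin : ∀ {p} (N : ℕ) (P : Fin N → Set p) → (∀ i → Dec (P i)) → ℕ
countFin zero    P P? = 0
countFin (suc N) P P? with P? Fin.zero
... | yes _ = suc (countFin N (λ i → P (Fin.suc i)) (λ i → P? (Fin.suc i)))
... | no  _ = countFin N (λ i → P (Fin.suc i)) (λ i → P? (Fin.suc i))

-- all unordered pairs {x , y} of entries at distinct positions of a list
pairs2 : ∀ {a} {A : Set a} → List A → List (A × A)
pairs2 [] = []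
pairs2 (x ∷ xs) = map (x ,_) xs ++ pairs2 xs

rangeℤ : ℤ → ℕ → List ℤ
rangeℤ a zero = []
rangeℤ a (suc len) = a ∷ rangeℤ (a ℤ.+ + 1) len

record FiniteAbelianGroup (c ℓ : Level) : Set (lsuc (c ⊔ ℓ)) where
  field
    abGroup   : AbelianGroup c ℓ
  open AbelianGroup abGroup public
  field
    size      : ℕ
    enum      : Fin size → Carrier
    enum-surj : ∀ x → ∃ λ i → enum i ≈ x
    enum-inj  : ∀ i j → enum i ≈ enum j → i ≡ j

module FAG {c ℓ} (G : FiniteAbelianGroup c ℓ) where
  open FiniteAbelianGroup G

  _≟_ : ∀ x y → Dec (x ≈ y)
  x ≟ y with enum-surj x | enum-surj y
  ... | i , ix | j , jy with i Fin.≟ j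
  ... | yes Relation.Binary.PropositionalEquality.refl =
          yes (trans (sym ix) jy)
  ... | no i≢j = no λ x≈y → i≢j (enum-inj i j (trans ix (trans x≈y (sym jy))))

  _·_ : ℕ → Carrier → Carrier
  zero  · g = ε
  suc k · g = g ∙ (k · g)

  _·ℤ_ : ℤ → Carrier → Carrier
  (+ k)     ·ℤ g = k · g
  -[1+ k ]  ·ℤ g = (suc k · g) ⁻¹

  HasOrder : ℕ → Carrier → Set ℓ
  HasOrder l g = (l · g ≈ ε) × (∀ (k : Fin l) → 1 ≤ toℕ k → ¬ (toℕ k · g ≈ ε))

  hasOrder? : ∀ l g → Dec (HasOrder l g)
  hasOrder? l g = ((l · g) ≟ ε) ×-dec all? (λ k → (1 ≤? toℕ k) →-dec ¬? ((toℕ k · g) ≟ ε))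

  mOrd : ℕ → ℕ
  mOrd l = countFin size (λ i → HasOrder l (enum i)) (λ i → hasOrder? l (enum i))

  sumG : ∀ {n} → (Fin n → Carrier) → Carrier
  sumG {zero}  f = ε
  sumG {suc n} f = f Fin.zero ∙ sumG (λ i → f (Fin.suc i))

  -- G ≥ M ◇_t S  with M = [a,b]^* (so M ∪ {0} = [a,b], a ≤ 0 ≤ b)

  wt : ∀ {n} → (Fin n → ℤ) → ℕ
  wt {n} e = countFin n (λ i → e i ≢ + 0) (λ i → ¬? (e i ℤ.≟ + 0))

  Admissible : ∀ {n} → ℤ → ℤ → ℕ → (Fin n → ℤ) → Set
  Admissible a b t e = (∀ i → a ℤ.≤ e i × e i ℤ.≤ b) × (1 ≤ wt e × wt e ≤ t)

  lin : ∀ {n} → (Fin n → ℤ) → (Fin n → Carrier) → Carrier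
  lin e s = sumG (λ i → e i ·ℤ s i)

  Diamond : ∀ {n} → ℤ → ℤ → ℕ → (Fin n → Carrier) → Set ℓ
  Diamond a b t s =
    (∀ e → Admissible a b t e → ¬ (lin e s ≈ ε)) ×
    (∀ e e' → Admissible a b t e → Admissible a b t e' →
       ¬ (∀ i → e i ≡ e' i) → ¬ (lin e s ≈ lin e' s))

  -- extended indexing: s_{i+kn} = (k+1) s_i, s_{i-kn} = -k s_i, s_∞ = 0

  data JIdx : Set where
    fin : ℤ → JIdx
    ∞   : JIdx

  -- s_j for an integer index j: write j = i + q n with i ∈ [1,n]
  sExt : ∀ n → (Fin n → Carrier) → JIdx → Carrier
  sExt n s ∞ = ε
  sExt zero s (fin j) = ε
  sExt (suc n') s (fin j) = coeff q ·ℤ s r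
    where
      N = suc n'
      r : Fin N
      r = fromℕ< (n%ℕd<d (j ℤ.- + 1) N)
      q : ℤ
      q = (j ℤ.- + 1) /ℕ N
      coeff : ℤ → ℤ
      coeff (+ k) = + suc k
      coeff -[1+ k ] = -[1+ k ]

  -- J = [1 - n(m-1), nm] ∪ {∞}
  Jlist : ℕ → ℕ → List JIdx
  Jlist n m = ∞ ∷ map fin (rangeℤ (+ 1 ℤ.- + (n ℕ.* (m ℕ.∸ 1))) (n ℕ.* m ℕ.+ n ℕ.* (m ℕ.∸ 1)))

  Cong : ℕ → JIdx → JIdx → Set
  Cong n ∞ ∞ = Data.Unit.⊤
  Cong n ∞ (fin _) = Data.Empty.⊥
  Cong n (fin _) ∞ = Data.Empty.⊥
  Cong n (fin a) (fin b) = (+ n) ∣ (a ℤ.- b)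

  cong? : ∀ n x y → Dec (Cong n x y)
  cong? n ∞ ∞ = yes Data.Unit.tt
  cong? n ∞ (fin _) = no λ ()
  cong? n (fin _) ∞ = no λ ()
  cong? n (fin a) (fin b) = n ℕD.∣? ℤ.∣ a ℤ.- b ∣

  -- Δ = {(i,j) ∈ J² : i ≢ j mod n}  (membership in J² comes from JJlist)
  InΔ : ℕ → JIdx × JIdx → Set
  InΔ n (i , j) = ¬ Cong n i j

  JJlist : ℕ → ℕ → List (JIdx × JIdx)
  JJlist n m = cartesianProduct (Jlist n m) (Jlist n m)

  M2Cond : ∀ n → (Fin n → Carrier) → (JIdx × JIdx) × (JIdx × JIdx) → Set ℓ
  M2Cond n s ((i , j) , (k , l)) =
    (InΔ n (i , j) × InΔ n (k , l)) ×
    ((Cong n i l × Cong n k j) ×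
     ((sExt n s i ∙ (sExt n s j ⁻¹)) ≈ (sExt n s k ∙ (sExt n s l ⁻¹))))

  M2Cond? : ∀ n s p → Dec (M2Cond n s p)
  M2Cond? n s ((i , j) , (k , l)) =
    (¬? (cong? n i j) ×-dec ¬? (cong? n k l)) ×-dec
    ((cong? n i l ×-dec cong? n k j) ×-dec
     ((sExt n s i ∙ (sExt n s j ⁻¹)) ≟ (sExt n s k ∙ (sExt n s l ⁻¹))))

  M2 : ∀ n m → (Fin n → Carrier) → ℕ
  M2 n m s = countL (M2Cond n s) (M2Cond? n s) (pairs2 (JJlist n m))

  Ccount : ∀ n m → (Fin n → Carrier) → ℕ
  Ccount n m s = countFin n (λ i → (2 ℕ.* m) · s i ≈ ε) (λ i → ((2 ℕ.* m) · s i) ≟ ε)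

-- Every extended index decodes to a point: ∞, or a pair (r , c) standing for c · s_r with
-- c ∈ A = [1 - m, m]^*.  A counted equation s_i - s_j = s_k - s_l becomes a solution of
-- a + d = c + b with a, d in one class (∞ or a residue p) and b, c in another, so M₂ is
-- bounded by a sum over ordered pairs of distinct classes.  Since G ≥ [1 - m, m]^* ◇₂ s,
-- coefficient vectors of weight at most two are determined by their values.  Hence in
-- α s_p + δ s_p = γ s_q + β s_q both sides vanish unless a coefficient m occurs, and every
-- remaining solution yields an equation 2m s_p = β s_q + γ s_q.  If 2m s_p ≠ 0, such an
-- equation exists for at most one q; if 2m s_p = 0, it forces β + γ = 0.  Equations
-- 2m s_p = 2m s_q only link two generators that are both, or both not, killed by 2m, and
-- p ↦ m s_p maps the generators killed by 2m injectively to elements of order 2.  Without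
-- elements of order 2m nothing is killed by 2m and no equation 2m s_p = 2m s_q (p ≠ q)
-- holds.

module Submission where

open import Defs
open import Function.Base using (_∘_)
open import Data.Empty using (⊥; ⊥-elim)
open import Data.Product using (∃-syntax; _×_; _,_; proj₁; proj₂; swap)
open import Data.Sum using (_⊎_; inj₁; inj₂)
open import Data.Maybe using (Maybe; just; nothing)
import Data.Maybe.Properties as Maybeₚ
open import Data.Unit using (tt)
open import Data.Nat as ℕ using (ℕ; zero; suc; _+_; _*_; _≤_; _<_; z≤n; s≤s)
import Data.Nat.Properties as ℕₚ
import Data.Nat.Divisibility as ℕ∣
import Data.Nat.Tactic.RingSolver as ℕ-Solver
import Data.Integer.Tactic.RingSolver as ℤ-Solver
open import Data.Integer as ℤ using (ℤ; +_; -[1+_])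
import Data.Integer.Properties as ℤₚ
open import Data.Fin as Fin using (Fin; toℕ)
import Data.Fin.Properties as Finₚ
open import Data.List using (List; []; _∷_; _++_; map; concat; length; allFin; upTo; cartesianProduct)
open import Data.List.Properties using (map-tabulate; length-++; length-map; length-upTo; length-tabulate)
open import Data.List.Membership.Propositional using (_∈_)
open import Data.List.Membership.Propositional.Properties
  using (∈-∃++; ∈-++⁻; ∈-++⁺ˡ; ∈-++⁺ʳ; ∈-allFin; ∈-map⁺; ∈-map⁻; ∈-upTo⁺; ∈-upTo⁻; ∈-concat⁺′)
open import Data.List.Relation.Unary.Any using (here; there)
import Data.List.Relation.Unary.All as All
open import Data.List.Relation.Unary.AllPairs using ([]; _∷_)
open import Data.List.Relation.Unary.Unique.Propositional using (Unique)
import Data.List.Relation.Unary.Unique.Propositional.Properties as Uniqueₚ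
open import Relation.Nullary using (¬_; Dec; yes; no)
open import Relation.Nullary.Decidable using (¬?; _×-dec_; decidable-stable)
open import Relation.Binary.Definitions using (DecidableEquality)
open import Relation.Binary.PropositionalEquality as ≡ using (_≡_; _≢_; refl; cong; cong₂; subst; subst₂)

∑ : ∀ {a} {A : Set a} → List A → (A → ℕ) → ℕ
∑ []       f = 0
∑ (x ∷ xs) f = f x + ∑ xs f

infixr 6.5 ∑
syntax ∑ xs (λ x → e) = ∑[ x ∈ xs ] e

𝟙 : ∀ {p} {P : Set p} → Dec P → ℕ
𝟙 (yes _) = 1
𝟙 (no  _) = 0

module _ {p} {P : Set p} where

  𝟙≤1 : (P? : Dec P) → 𝟙 P? ≤ 1
  𝟙≤1 (yes _) = s≤s z≤n
  𝟙≤1 (no  _) = z≤n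

  𝟙-yes : (P? : Dec P) → P → 𝟙 P? ≡ 1
  𝟙-yes (yes _) _  = refl
  𝟙-yes (no ¬p) pr = ⊥-elim (¬p pr)

  𝟙-no : (P? : Dec P) → ¬ P → 𝟙 P? ≡ 0
  𝟙-no (yes pr) ¬p = ⊥-elim (¬p pr)
  𝟙-no (no  _)  _  = refl

  𝟙≢0⇒ : (P? : Dec P) → 𝟙 P? ≢ 0 → P
  𝟙≢0⇒ (yes pr) _   = pr
  𝟙≢0⇒ (no  _)  1≢0 = ⊥-elim (1≢0 refl)

  𝟙+𝟙¬ : (P? : Dec P) → 𝟙 P? + 𝟙 (¬? P?) ≡ 1
  𝟙+𝟙¬ (yes _) = refl
  𝟙+𝟙¬ (no  _) = refl

  𝟙*𝟙 : (P? : Dec P) → 𝟙 P? * 𝟙 P? ≡ 𝟙 P?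
  𝟙*𝟙 (yes _) = refl
  𝟙*𝟙 (no  _) = refl

module _ {p q} {P : Set p} {Q : Set q} where

  𝟙-mono : (P? : Dec P) (Q? : Dec Q) → (P → Q) → 𝟙 P? ≤ 𝟙 Q?
  𝟙-mono (yes pr) Q? P⇒Q = ℕₚ.≤-reflexive (≡.sym (𝟙-yes Q? (P⇒Q pr)))
  𝟙-mono (no  _)  Q? P⇒Q = z≤n

∑-map : ∀ {a b} {A : Set a} {B : Set b} (g : A → B) xs f → ∑ (map g xs) f ≡ ∑ xs (f ∘ g)
∑-map g []       f = refl
∑-map g (x ∷ xs) f = cong (_+_ (f (g x))) (∑-map g xs f)

module _ {a} {A : Set a} where

  ∑-++ : ∀ (xs ys : List A) f → ∑ (xs ++ ys) f ≡ ∑ xs f + ∑ ys f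
  ∑-++ []       ys f = refl
  ∑-++ (x ∷ xs) ys f = ≡.trans (cong (_+_ (f x)) (∑-++ xs ys f)) (≡.sym (ℕₚ.+-assoc (f x) _ _))

  ∑-cong : ∀ (xs : List A) {f g} → (∀ x → x ∈ xs → f x ≡ g x) → ∑ xs f ≡ ∑ xs g
  ∑-cong []       f≗g = refl
  ∑-cong (x ∷ xs) f≗g = cong₂ _+_ (f≗g x (here refl)) (∑-cong xs (λ y y∈ → f≗g y (there y∈)))

  ∑-mono : ∀ (xs : List A) {f g} → (∀ x → x ∈ xs → f x ≤ g x) → ∑ xs f ≤ ∑ xs g
  ∑-mono []       f≤g = z≤n
  ∑-mono (x ∷ xs) f≤g = ℕₚ.+-mono-≤ (f≤g x (here refl)) (∑-mono xs (λ y y∈ → f≤g y (there y∈)))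

  ∑-zero : ∀ (xs : List A) {f} → (∀ x → x ∈ xs → f x ≡ 0) → ∑ xs f ≡ 0
  ∑-zero []       f≗0 = refl
  ∑-zero (x ∷ xs) f≗0 = cong₂ _+_ (f≗0 x (here refl)) (∑-zero xs (λ y y∈ → f≗0 y (there y∈)))

  ∑-+ : ∀ (xs : List A) f g → ∑[ x ∈ xs ] (f x + g x) ≡ ∑ xs f + ∑ xs g
  ∑-+ []       f g = refl
  ∑-+ (x ∷ xs) f g rewrite ∑-+ xs f g = middle-swap (f x) (g x) (∑ xs f) (∑ xs g)
    where
    middle-swap : ∀ a b c d → a + b + (c + d) ≡ a + c + (b + d)
    middle-swap = ℕ-Solver.solve-∀

  ∑-*ˡ : ∀ (xs : List A) k f → ∑[ x ∈ xs ] (k * f x) ≡ k * ∑ xs f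
  ∑-*ˡ []       k f = ≡.sym (ℕₚ.*-zeroʳ k)
  ∑-*ˡ (x ∷ xs) k f = ≡.trans (cong (_+_ (k * f x)) (∑-*ˡ xs k f)) (≡.sym (ℕₚ.*-distribˡ-+ k (f x) _))

  ∑-*ʳ : ∀ (xs : List A) f k → ∑[ x ∈ xs ] (f x * k) ≡ ∑ xs f * k
  ∑-*ʳ xs f k = ≡.trans (∑-cong xs (λ x _ → ℕₚ.*-comm (f x) k))
                        (≡.trans (∑-*ˡ xs k f) (ℕₚ.*-comm k (∑ xs f)))

  ∑-const : ∀ (xs : List A) k → ∑ xs (λ _ → k) ≡ length xs * k
  ∑-const []       k = refl
  ∑-const (x ∷ xs) k = cong (_+_ k) (∑-const xs k)

  ∑-member : ∀ {xs : List A} {x} f → x ∈ xs → f x ≤ ∑ xs f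
  ∑-member f (here refl) = ℕₚ.m≤m+n _ _
  ∑-member {y ∷ _} f (there x∈) = ℕₚ.≤-trans (∑-member f x∈) (ℕₚ.m≤n+m _ (f y))

  ∑-nonzero : ∀ (xs : List A) {f} → ∑ xs f ≢ 0 → ∃[ x ] x ∈ xs × f x ≢ 0
  ∑-nonzero []       ∑≢0 = ⊥-elim (∑≢0 refl)
  ∑-nonzero (x ∷ xs) {f} ∑≢0 with f x ℕ.≟ 0
  ... | no  fx≢0 = x , here refl , fx≢0
  ... | yes fx≡0 with ∑-nonzero xs (λ ∑xs≡0 → ∑≢0 (cong₂ _+_ fx≡0 ∑xs≡0))
  ...   | y , y∈ , fy≢0 = y , there y∈ , fy≢0

  ∑-atMostOne : ∀ {xs : List A} {f} K → Unique xs → (∀ x → x ∈ xs → f x ≤ K) →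
                (∀ x y → x ∈ xs → y ∈ xs → f x ≢ 0 → f y ≢ 0 → x ≡ y) → ∑ xs f ≤ K
  ∑-atMostOne {[]}     K _ _ _ = z≤n
  ∑-atMostOne {x ∷ xs} {f} K (x∉xs ∷ unique) f≤K one with f x ℕ.≟ 0
  ... | yes fx≡0 rewrite fx≡0 =
    ∑-atMostOne K unique (λ y y∈ → f≤K y (there y∈)) (λ y z y∈ z∈ → one y z (there y∈) (there z∈))
  ... | no fx≢0 = begin
    f x + ∑ xs f ≡⟨ cong (_+_ (f x)) (∑-zero xs rest-zero) ⟩
    f x + 0      ≡⟨ ℕₚ.+-identityʳ (f x) ⟩
    f x          ≤⟨ f≤K x (here refl) ⟩
    K            ∎
    where
    open ℕₚ.≤-Reasoning
    rest-zero : ∀ y → y ∈ xs → f y ≡ 0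
    rest-zero y y∈ with f y ℕ.≟ 0
    ... | yes fy≡0 = fy≡0
    ... | no  fy≢0 = ⊥-elim (All.lookup x∉xs y∈ (one x y (here refl) (there y∈) fx≢0 fy≢0))

  ∑-single : ∀ {xs : List A} {f} y → Unique xs → (∀ x → x ∈ xs → f x ≢ 0 → x ≡ y) → ∑ xs f ≤ f y
  ∑-single {f = f} y unique only-y = ∑-atMostOne (f y) unique bound
    (λ x z x∈ z∈ fx≢0 fz≢0 → ≡.trans (only-y x x∈ fx≢0) (≡.sym (only-y z z∈ fz≢0)))
    where
    bound : ∀ x → x ∈ _ → f x ≤ f y
    bound x x∈ with f x ℕ.≟ 0
    ... | yes fx≡0 = subst (_≤ f y) (≡.sym fx≡0) z≤n
    ... | no  fx≢0 = ℕₚ.≤-reflexive (cong f (only-y x x∈ fx≢0))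

  ∑-𝟙≤1 : ∀ {p} {P : A → Set p} (P? : ∀ x → Dec (P x)) {xs} → Unique xs →
          (∀ x y → x ∈ xs → y ∈ xs → P x → P y → x ≡ y) → ∑[ x ∈ xs ] 𝟙 (P? x) ≤ 1
  ∑-𝟙≤1 P? unique one = ∑-atMostOne 1 unique (λ x _ → 𝟙≤1 (P? x))
    (λ x y x∈ y∈ x≢0 y≢0 → one x y x∈ y∈ (𝟙≢0⇒ (P? x) x≢0) (𝟙≢0⇒ (P? y) y≢0))

  ∑-𝟙-≟≤1 : (_≟_ : DecidableEquality A) {xs : List A} → Unique xs → ∀ z → ∑[ x ∈ xs ] 𝟙 (x ≟ z) ≤ 1
  ∑-𝟙-≟≤1 _≟_ unique z = ∑-𝟙≤1 (_≟ z) unique (λ _ _ _ _ x≡z y≡z → ≡.trans x≡z (≡.sym y≡z))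

  ∑-⊆ : ∀ {xs ys : List A} f → Unique xs → (∀ {x} → x ∈ xs → x ∈ ys) → ∑ xs f ≤ ∑ ys f
  ∑-⊆ {[]}     f _ _ = z≤n
  ∑-⊆ {x ∷ xs} f (x∉xs ∷ unique) xs⊆ys with ∈-∃++ (xs⊆ys (here refl))
  ... | ys₁ , ys₂ , refl = begin
    f x + ∑ xs f                   ≤⟨ ℕₚ.+-monoʳ-≤ (f x) (∑-⊆ f unique xs⊆ys₁++ys₂) ⟩
    f x + ∑ (ys₁ ++ ys₂) f         ≡⟨ cong (_+_ (f x)) (∑-++ ys₁ ys₂ f) ⟩
    f x + (∑ ys₁ f + ∑ ys₂ f)      ≡⟨ left-comm (f x) (∑ ys₁ f) (∑ ys₂ f) ⟩
    ∑ ys₁ f + (f x + ∑ ys₂ f)      ≡⟨ ≡.sym (∑-++ ys₁ (x ∷ ys₂) f) ⟩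
    ∑ (ys₁ ++ x ∷ ys₂) f           ∎
    where
    open ℕₚ.≤-Reasoning
    left-comm : ∀ a b c → a + (b + c) ≡ b + (a + c)
    left-comm = ℕ-Solver.solve-∀
    xs⊆ys₁++ys₂ : ∀ {y} → y ∈ xs → y ∈ ys₁ ++ ys₂
    xs⊆ys₁++ys₂ {y} y∈ with ∈-++⁻ ys₁ (xs⊆ys (there y∈))
    ... | inj₁ y∈ys₁         = ∈-++⁺ˡ y∈ys₁
    ... | inj₂ (here y≡x)    = ⊥-elim (All.lookup x∉xs y∈ (≡.sym y≡x))
    ... | inj₂ (there y∈ys₂) = ∈-++⁺ʳ ys₁ y∈ys₂

  ∑-concat : ∀ (xss : List (List A)) f → ∑ (concat xss) f ≡ ∑[ xs ∈ xss ] ∑ xs f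
  ∑-concat []         f = refl
  ∑-concat (xs ∷ xss) f = ≡.trans (∑-++ xs (concat xss) f) (cong (_+_ (∑ xs f)) (∑-concat xss f))

∑-pairs2 : ∀ {a} {A : Set a} (xs : List A) (f : A → A → ℕ) →
           ∑ (pairs2 xs) (λ (x , y) → f x y + f y x) ≤ ∑[ x ∈ xs ] ∑[ y ∈ xs ] f x y
∑-pairs2 []       f = z≤n
∑-pairs2 {A = A} (x ∷ xs) f = begin
  ∑ (map (x ,_) xs ++ pairs2 xs) g                        ≡⟨ ∑-++ (map (x ,_) xs) (pairs2 xs) g ⟩
  ∑ (map (x ,_) xs) g + ∑ (pairs2 xs) g                    ≡⟨ cong (_+ ∑ (pairs2 xs) g) (∑-map (x ,_) xs g) ⟩
  ∑[ y ∈ xs ] (f x y + f y x) + ∑ (pairs2 xs) g            ≤⟨ ℕₚ.+-monoʳ-≤ _ (∑-pairs2 xs f) ⟩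
  ∑[ y ∈ xs ] (f x y + f y x) + R                          ≡⟨ cong (_+ R) (∑-+ xs (f x) (λ y → f y x)) ⟩
  ∑ xs (f x) + ∑[ y ∈ xs ] f y x + R                       ≡⟨ ℕₚ.+-assoc (∑ xs (f x)) _ R ⟩
  ∑ xs (f x) + (∑[ y ∈ xs ] f y x + R)                     ≤⟨ ℕₚ.m≤n+m _ (f x x) ⟩
  f x x + (∑ xs (f x) + (∑[ y ∈ xs ] f y x + R))           ≡⟨ ≡.sym (cong (λ r → f x x + (∑ xs (f x) + r))
                                                                (∑-+ xs (λ y → f y x) (λ y → ∑ xs (f y)))) ⟩
  f x x + (∑ xs (f x) + ∑[ y ∈ xs ] (f y x + ∑ xs (f y)))  ≡⟨ ≡.sym (ℕₚ.+-assoc (f x x) _ _) ⟩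
  f x x + ∑ xs (f x) + ∑[ y ∈ xs ] (f y x + ∑ xs (f y))    ∎
  where
  open ℕₚ.≤-Reasoning
  g : A × A → ℕ
  g (u , v) = f u v + f v u
  R : ℕ
  R = ∑[ y ∈ xs ] ∑ xs (f y)

module _ {a b} {A : Set a} {B : Set b} where

  ∑-swap : ∀ (xs : List A) (ys : List B) (f : A → B → ℕ) →
           ∑[ x ∈ xs ] ∑[ y ∈ ys ] f x y ≡ ∑[ y ∈ ys ] ∑[ x ∈ xs ] f x y
  ∑-swap []       ys f = ≡.sym (∑-zero ys (λ _ _ → refl))
  ∑-swap (x ∷ xs) ys f = ≡.trans (cong (_+_ (∑ ys (f x))) (∑-swap xs ys f))
                                 (≡.sym (∑-+ ys (f x) (λ y → ∑[ x′ ∈ xs ] f x′ y)))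

  ∑-cartesianProduct : ∀ (xs : List A) (ys : List B) f →
                       ∑ (cartesianProduct xs ys) f ≡ ∑[ x ∈ xs ] ∑[ y ∈ ys ] f (x , y)
  ∑-cartesianProduct []       ys f = refl
  ∑-cartesianProduct (x ∷ xs) ys f =
    ≡.trans (∑-++ (map (x ,_) ys) _ f) (cong₂ _+_ (∑-map (x ,_) ys f) (∑-cartesianProduct xs ys f))

  ∑∑-𝟙-fibreʳ : ∀ {p q} {P : A → B → Set p} {Q : A → Set q} (P? : ∀ x y → Dec (P x y)) (Q? : ∀ x → Dec (Q x))
                {xs ys} y₀ → Unique ys → (∀ x y → x ∈ xs → y ∈ ys → P x y → Q x × y ≡ y₀) →
                ∑[ x ∈ xs ] ∑[ y ∈ ys ] 𝟙 (P? x y) ≤ ∑[ x ∈ xs ] 𝟙 (Q? x)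
  ∑∑-𝟙-fibreʳ P? Q? {xs} y₀ unique fibre = ∑-mono xs λ x x∈ →
    ∑-atMostOne (𝟙 (Q? x)) unique
      (λ y y∈ → 𝟙-mono (P? x y) (Q? x) (proj₁ ∘ fibre x y x∈ y∈))
      (λ y y′ y∈ y′∈ nz nz′ → ≡.trans (proj₂ (fibre x y x∈ y∈ (𝟙≢0⇒ (P? x y) nz)))
                                      (≡.sym (proj₂ (fibre x y′ x∈ y′∈ (𝟙≢0⇒ (P? x y′) nz′)))))

∑∑-𝟙-fibreˡ : ∀ {a b p q} {A : Set a} {B : Set b} {P : A → B → Set p} {Q : B → Set q}
              (P? : ∀ x y → Dec (P x y)) (Q? : ∀ y → Dec (Q y))
              {xs ys} x₀ → Unique xs → (∀ x y → x ∈ xs → y ∈ ys → P x y → x ≡ x₀ × Q y) →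
              ∑[ x ∈ xs ] ∑[ y ∈ ys ] 𝟙 (P? x y) ≤ ∑[ y ∈ ys ] 𝟙 (Q? y)
∑∑-𝟙-fibreˡ P? Q? {xs} {ys} x₀ unique fibre = ℕₚ.≤-trans (ℕₚ.≤-reflexive (∑-swap xs ys _))
  (∑∑-𝟙-fibreʳ (λ y x → P? x y) Q? x₀ unique (λ y x y∈ x∈ pxy → swap (fibre x y x∈ y∈ pxy)))

∑-allFin-suc : ∀ {n} f → ∑ (allFin (suc n)) f ≡ f Fin.zero + ∑[ i ∈ allFin n ] f (Fin.suc i)
∑-allFin-suc {n} f = cong (_+_ (f Fin.zero))
  (≡.trans (cong (λ is → ∑ is f) (≡.sym (map-tabulate (λ i → i) Fin.suc))) (∑-map Fin.suc (allFin n) f))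

countL≡∑ : ∀ {a p} {A : Set a} (P : A → Set p) (P? : ∀ x → Dec (P x)) xs →
           countL P P? xs ≡ ∑[ x ∈ xs ] 𝟙 (P? x)
countL≡∑ P P? []       = refl
countL≡∑ P P? (x ∷ xs) with P? x
... | yes _ = cong suc (countL≡∑ P P? xs)
... | no  _ = countL≡∑ P P? xs

countFin≡∑ : ∀ {p} n (P : Fin n → Set p) (P? : ∀ i → Dec (P i)) →
             countFin n P P? ≡ ∑[ i ∈ allFin n ] 𝟙 (P? i)
countFin≡∑ zero    P P? = refl
countFin≡∑ (suc n) P P? = ≡.trans (head+rest (P? Fin.zero)) (≡.sym (∑-allFin-suc (λ i → 𝟙 (P? i))))
  where
  rest : countFin n (λ i → P (Fin.suc i)) (λ i → P? (Fin.suc i)) ≡ ∑[ i ∈ allFin n ] 𝟙 (P? (Fin.suc i))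
  rest = countFin≡∑ n (λ i → P (Fin.suc i)) (λ i → P? (Fin.suc i))
  head+rest : (P₀? : Dec (P Fin.zero)) → countFin (suc n) P P? ≡ 𝟙 (P? Fin.zero) + ∑[ i ∈ allFin n ] 𝟙 (P? (Fin.suc i))
  head+rest _ with P? Fin.zero
  ... | yes _ = cong suc rest
  ... | no  _ = rest

[_≢_] : ∀ {n} → Fin n → Fin n → ℕ
[ p ≢ q ] = 𝟙 (¬? (p Fin.≟ q))

∑-allFin-split : ∀ {n} (p : Fin n) f → ∑ (allFin n) f ≡ f p + ∑[ q ∈ allFin n ] [ p ≢ q ] * f q
∑-allFin-split {n} p f = begin
  ∑ (allFin n) f                                           ≡⟨ ∑-cong (allFin n) (λ q _ → split q) ⟩
  ∑[ q ∈ allFin n ] (𝟙 (p Fin.≟ q) * f q + [ p ≢ q ] * f q) ≡⟨ ∑-+ (allFin n) _ _ ⟩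
  ∑[ q ∈ allFin n ] 𝟙 (p Fin.≟ q) * f q + ∑[ q ∈ allFin n ] [ p ≢ q ] * f q
                                                           ≡⟨ cong (_+ ∑[ q ∈ allFin n ] [ p ≢ q ] * f q) at-p ⟩
  f p + ∑[ q ∈ allFin n ] [ p ≢ q ] * f q                  ∎
  where
  open ≡.≡-Reasoning
  split : ∀ q → f q ≡ 𝟙 (p Fin.≟ q) * f q + [ p ≢ q ] * f q
  split q = ≡.trans (≡.sym (ℕₚ.*-identityˡ (f q)))
            (≡.trans (cong (_* f q) (≡.sym (𝟙+𝟙¬ (p Fin.≟ q)))) (ℕₚ.*-distribʳ-+ (f q) (𝟙 (p Fin.≟ q)) [ p ≢ q ]))
  f-at-p : 𝟙 (p Fin.≟ p) * f p ≡ f p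
  f-at-p = ≡.trans (cong (_* f p) (𝟙-yes (p Fin.≟ p) refl)) (ℕₚ.*-identityˡ (f p))
  at-p : ∑[ q ∈ allFin n ] 𝟙 (p Fin.≟ q) * f q ≡ f p
  at-p = ℕₚ.≤-antisym
    (ℕₚ.≤-trans (∑-single p (Uniqueₚ.allFin⁺ n)
                  (λ q _ nz → ≡.sym (𝟙≢0⇒ (p Fin.≟ q) (nz ∘ cong (_* f q)))))
                (ℕₚ.≤-reflexive f-at-p))
    (ℕₚ.≤-trans (ℕₚ.≤-reflexive (≡.sym f-at-p)) (∑-member (λ q → 𝟙 (p Fin.≟ q) * f q) (∈-allFin p)))

[≢]-sym : ∀ {n} (p q : Fin n) → [ p ≢ q ] ≡ [ q ≢ p ]
[≢]-sym p q = ℕₚ.≤-antisym (𝟙-mono _ _ (λ p≢q → p≢q ∘ ≡.sym)) (𝟙-mono _ _ (λ q≢p → q≢p ∘ ≡.sym))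

∑-others-const : ∀ {n} (p : Fin (suc n)) c → ∑[ q ∈ allFin (suc n) ] [ p ≢ q ] * c ≡ n * c
∑-others-const {n} p c = ℕₚ.+-cancelˡ-≡ c _ _ (begin
  c + ∑[ q ∈ allFin (suc n) ] [ p ≢ q ] * c  ≡⟨ ≡.sym (∑-allFin-split p (λ _ → c)) ⟩
  ∑[ q ∈ allFin (suc n) ] c                  ≡⟨ ∑-const (allFin (suc n)) c ⟩
  length (allFin (suc n)) * c                ≡⟨ cong (_* c) (length-tabulate {n = suc n} (λ i → i)) ⟩
  c + n * c                                  ∎)
  where open ≡.≡-Reasoning

∑≢ : ∀ n → (Fin n → Fin n → ℕ) → ℕ
∑≢ n f = ∑[ p ∈ allFin n ] ∑[ q ∈ allFin n ] [ p ≢ q ] * f p q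

∑≢-+ : ∀ n f g → ∑≢ n (λ p q → f p q + g p q) ≡ ∑≢ n f + ∑≢ n g
∑≢-+ n f g = ≡.trans (∑-cong (allFin n) λ p _ →
    ≡.trans (∑-cong (allFin n) (λ q _ → ℕₚ.*-distribˡ-+ [ p ≢ q ] (f p q) (g p q)))
            (∑-+ (allFin n) (λ q → [ p ≢ q ] * f p q) (λ q → [ p ≢ q ] * g p q)))
  (∑-+ (allFin n) _ _)

∑≢-transpose : ∀ n f → ∑≢ n (λ p q → f q p) ≡ ∑≢ n f
∑≢-transpose n f = ≡.trans (∑-swap (allFin n) (allFin n) (λ p q → [ p ≢ q ] * f q p))
  (∑-cong (allFin n) λ q _ → ∑-cong (allFin n) λ p _ → cong (_* f q p) ([≢]-sym p q))

∑≢-const : ∀ n c → ∑≢ (suc n) (λ _ _ → c) ≡ suc n * (n * c)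
∑≢-const n c = ≡.trans (∑-cong (allFin (suc n)) (λ p _ → ∑-others-const p c))
  (≡.trans (∑-const (allFin (suc n)) (n * c)) (cong (_* (n * c)) (length-tabulate {n = suc n} (λ i → i))))

∑≢-square : ∀ n f → (∀ p → f p * f p ≡ f p) →
            ∑≢ n (λ p q → f p * f q) + ∑ (allFin n) f ≡ ∑ (allFin n) f * ∑ (allFin n) f
∑≢-square n f idem = begin
  ∑≢ n (λ p q → f p * f q) + ∑ (allFin n) f
    ≡⟨ cong₂ _+_ (∑-cong (allFin n) λ p _ → ≡.trans (∑-cong (allFin n) (λ q _ → left-comm [ p ≢ q ] (f p) (f q)))
                                                  (∑-*ˡ (allFin n) (f p) (λ q → [ p ≢ q ] * f q)))
                 (∑-cong (allFin n) (λ p _ → ≡.sym (idem p))) ⟩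
  ∑[ p ∈ allFin n ] f p * (∑[ q ∈ allFin n ] [ p ≢ q ] * f q) + ∑[ p ∈ allFin n ] f p * f p
    ≡⟨ ≡.sym (∑-+ (allFin n) _ _) ⟩
  ∑[ p ∈ allFin n ] (f p * (∑[ q ∈ allFin n ] [ p ≢ q ] * f q) + f p * f p)
    ≡⟨ ∑-cong (allFin n) (λ p _ → ≡.trans (≡.sym (ℕₚ.*-distribˡ-+ (f p) _ (f p)))
                                  (cong (f p *_) (≡.trans (ℕₚ.+-comm _ (f p)) (≡.sym (∑-allFin-split p f))))) ⟩
  ∑[ p ∈ allFin n ] f p * ∑ (allFin n) f
    ≡⟨ ∑-*ʳ (allFin n) f (∑ (allFin n) f) ⟩
  ∑ (allFin n) f * ∑ (allFin n) f ∎
  where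
  open ≡.≡-Reasoning
  left-comm : ∀ a b c → a * (b * c) ≡ b * (a * c)
  left-comm = ℕ-Solver.solve-∀

module GroupProperties {c ℓ} (G : FiniteAbelianGroup c ℓ) where

  open FiniteAbelianGroup G renaming (refl to ≈-refl; sym to ≈-sym; trans to ≈-trans)
  open FAG G
  open import Algebra.Properties.AbelianGroup abGroup
  open import Algebra.Properties.CommutativeSemigroup commutativeSemigroup using (interchange)
  open import Relation.Binary.Reasoning.Setoid setoid

  ·-cong : ∀ k {g h} → g ≈ h → k · g ≈ k · h
  ·-cong zero    g≈h = ≈-refl
  ·-cong (suc k) g≈h = ∙-cong g≈h (·-cong k g≈h)

  ·-+ : ∀ a b g → (a + b) · g ≈ a · g ∙ b · g
  ·-+ zero    b g = ≈-sym (identityˡ _)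
  ·-+ (suc a) b g = ≈-trans (∙-congˡ (·-+ a b g)) (≈-sym (assoc _ _ _))

  ·-double : ∀ m g → (2 * m) · g ≈ m · g ∙ m · g
  ·-double m g = ≈-trans (reflexive (cong (λ k → (m + k) · g) (ℕₚ.+-identityʳ m))) (·-+ m m g)

  ·-∙⁻¹ : ∀ k g h → k · (g ∙ h ⁻¹) ≈ k · g ∙ (k · h) ⁻¹
  ·-∙⁻¹ zero    g h = ≈-sym (≈-trans (∙-congˡ ε⁻¹≈ε) (identityʳ ε))
  ·-∙⁻¹ (suc k) g h = begin
    (g ∙ h ⁻¹) ∙ k · (g ∙ h ⁻¹)          ≈⟨ ∙-congˡ (·-∙⁻¹ k g h) ⟩
    (g ∙ h ⁻¹) ∙ (k · g ∙ (k · h) ⁻¹)    ≈⟨ interchange _ _ _ _ ⟩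
    (g ∙ k · g) ∙ (h ⁻¹ ∙ (k · h) ⁻¹)    ≈⟨ ∙-congˡ (⁻¹-∙-comm h (k · h)) ⟩
    (g ∙ k · g) ∙ (h ∙ k · h) ⁻¹         ∎

  ·ℤ-neg : ∀ z g → (ℤ.- z) ·ℤ g ≈ (z ·ℤ g) ⁻¹
  ·ℤ-neg (+ zero)  g = ≈-sym ε⁻¹≈ε
  ·ℤ-neg (+ suc k) g = ≈-refl
  ·ℤ-neg -[1+ k ]  g = ≈-sym (⁻¹-involutive _)

  ∙≈∙⇒∙⁻¹≈∙⁻¹ : ∀ {a b c d} → a ∙ b ≈ c ∙ d → a ∙ d ⁻¹ ≈ c ∙ b ⁻¹
  ∙≈∙⇒∙⁻¹≈∙⁻¹ {a} {b} {c} {d} ab≈cd = begin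
    a ∙ d ⁻¹                  ≈⟨ ≈-sym (identityʳ _) ⟩
    a ∙ d ⁻¹ ∙ ε              ≈⟨ ∙-congˡ (≈-sym (inverseʳ b)) ⟩
    a ∙ d ⁻¹ ∙ (b ∙ b ⁻¹)     ≈⟨ interchange _ _ _ _ ⟩
    a ∙ b ∙ (d ⁻¹ ∙ b ⁻¹)     ≈⟨ ∙-congʳ ab≈cd ⟩
    c ∙ d ∙ (d ⁻¹ ∙ b ⁻¹)     ≈⟨ ∙-congˡ (comm _ _) ⟩
    c ∙ d ∙ (b ⁻¹ ∙ d ⁻¹)     ≈⟨ interchange _ _ _ _ ⟩
    c ∙ b ⁻¹ ∙ (d ∙ d ⁻¹)     ≈⟨ ∙-congˡ (inverseʳ d) ⟩
    c ∙ b ⁻¹ ∙ ε              ≈⟨ identityʳ _ ⟩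
    c ∙ b ⁻¹                  ∎

  ∙⁻¹≈∙⁻¹⇒∙≈∙ : ∀ {a b c d} → a ∙ b ⁻¹ ≈ c ∙ d ⁻¹ → a ∙ d ≈ c ∙ b
  ∙⁻¹≈∙⁻¹⇒∙≈∙ eq = ≈-trans (∙-congˡ (≈-sym (⁻¹-involutive _)))
                     (≈-trans (∙≈∙⇒∙⁻¹≈∙⁻¹ eq) (∙-congˡ (⁻¹-involutive _)))

  sumG-cong : ∀ {n} {f g : Fin n → Carrier} → (∀ i → f i ≈ g i) → sumG f ≈ sumG g
  sumG-cong {zero}  f≈g = ≈-refl
  sumG-cong {suc n} f≈g = ∙-cong (f≈g Fin.zero) (sumG-cong (λ i → f≈g (Fin.suc i)))

  sumG-ε : ∀ {n} {f : Fin n → Carrier} → (∀ i → f i ≈ ε) → sumG f ≈ ε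
  sumG-ε {zero}  f≈ε = ≈-refl
  sumG-ε {suc n} f≈ε = ≈-trans (∙-cong (f≈ε Fin.zero) (sumG-ε (λ i → f≈ε (Fin.suc i)))) (identityˡ ε)

  sumG-∙ : ∀ {n} (f g : Fin n → Carrier) → sumG (λ i → f i ∙ g i) ≈ sumG f ∙ sumG g
  sumG-∙ {zero}  f g = ≈-sym (identityˡ ε)
  sumG-∙ {suc n} f g = ≈-trans (∙-congˡ (sumG-∙ (λ i → f (Fin.suc i)) (λ i → g (Fin.suc i)))) (interchange _ _ _ _)

  sumG-single : ∀ {n} (p : Fin n) {f : Fin n → Carrier} → (∀ i → i ≢ p → f i ≈ ε) → sumG f ≈ f p
  sumG-single {suc n} Fin.zero    f≈ε = ≈-trans (∙-congˡ (sumG-ε (λ i → f≈ε (Fin.suc i) (λ ())))) (identityʳ _)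
  sumG-single {suc n} (Fin.suc p) f≈ε = ≈-trans (∙-congʳ (f≈ε Fin.zero (λ ())))
    (≈-trans (identityˡ _) (sumG-single p (λ i i≢p → f≈ε (Fin.suc i) (i≢p ∘ Finₚ.suc-injective))))

  HasOrder-resp : ∀ l {g h} → g ≈ h → HasOrder l g → HasOrder l h
  HasOrder-resp l g≈h (lg≈ε , minimal) =
    ≈-trans (·-cong l (≈-sym g≈h)) lg≈ε , λ k 1≤k kh≈ε → minimal k 1≤k (≈-trans (·-cong (toℕ k) g≈h) kh≈ε)

  HasOrder⇒mOrd-pos : ∀ l g → HasOrder l g → 1 ≤ mOrd l
  HasOrder⇒mOrd-pos l g ord with enum-surj g
  ... | i , enum-i≈g = subst (1 ≤_) (≡.sym (countFin≡∑ size _ _)) (ℕₚ.≤-trans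
    (ℕₚ.≤-reflexive (≡.sym (𝟙-yes (hasOrder? l (enum i)) (HasOrder-resp l (≈-sym enum-i≈g) ord))))
    (∑-member (λ j → 𝟙 (hasOrder? l (enum j))) (∈-allFin i)))

module Injectivity {c ℓ} (G : FiniteAbelianGroup c ℓ) {n : ℕ} {lo hi : ℤ}
                   (lo≤0 : lo ℤ.≤ + 0) (0≤hi : + 0 ℤ.≤ hi)
                   (s : Fin n → FiniteAbelianGroup.Carrier G) (D : FAG.Diamond G lo hi 2 s) where

  open FiniteAbelianGroup G renaming (refl to ≈-refl; sym to ≈-sym; trans to ≈-trans)
  open FAG G
  open GroupProperties G

  InRange : ℤ → Set
  InRange z = lo ℤ.≤ z × z ℤ.≤ hi

  0∈range : InRange (+ 0)
  0∈range = lo≤0 , 0≤hi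

  wt-zero : ∀ e → wt e ≡ 0 → ∀ i → e i ≡ + 0
  wt-zero e wt≡0 i = decidable-stable (e i ℤ.≟ + 0) λ ei≢0 → ℕₚ.1+n≰n (begin
    1                                          ≡⟨ ≡.sym (𝟙-yes (¬? (e i ℤ.≟ + 0)) ei≢0) ⟩
    𝟙 (¬? (e i ℤ.≟ + 0))                       ≤⟨ ∑-member (λ j → 𝟙 (¬? (e j ℤ.≟ + 0))) (∈-allFin i) ⟩
    ∑[ j ∈ allFin n ] 𝟙 (¬? (e j ℤ.≟ + 0))     ≡⟨ ≡.sym (countFin≡∑ n _ _) ⟩
    wt e                                       ≡⟨ wt≡0 ⟩
    0                                          ∎)
    where open ℕₚ.≤-Reasoning

  lin-zero : ∀ {e} → (∀ i → e i ≡ + 0) → lin e s ≈ ε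
  lin-zero e≡0 = sumG-ε (λ i → reflexive (cong (_·ℤ s i) (e≡0 i)))

  lin-injective : ∀ {e e′} → (∀ i → InRange (e i)) → wt e ≤ 2 → (∀ i → InRange (e′ i)) → wt e′ ≤ 2 →
                  lin e s ≈ lin e′ s → ∀ i → e i ≡ e′ i
  lin-injective {e} {e′} r w r′ w′ eq with wt e ℕ.≟ 0 | wt e′ ℕ.≟ 0
  ... | yes w≡0 | yes w′≡0 = λ i → ≡.trans (wt-zero e w≡0 i) (≡.sym (wt-zero e′ w′≡0 i))
  ... | yes w≡0 | no  w′≢0 =
    ⊥-elim (proj₁ D e′ (r′ , ℕₚ.n≢0⇒n>0 w′≢0 , w′) (≈-trans (≈-sym eq) (lin-zero (wt-zero e w≡0))))
  ... | no  w≢0 | yes w′≡0 =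
    ⊥-elim (proj₁ D e (r , ℕₚ.n≢0⇒n>0 w≢0 , w) (≈-trans eq (lin-zero (wt-zero e′ w′≡0))))
  ... | no  w≢0 | no  w′≢0 = λ i → decidable-stable (Finₚ.all? (λ j → e j ℤ.≟ e′ j))
    (λ e≢e′ → proj₂ D e e′ (r , ℕₚ.n≢0⇒n>0 w≢0 , w) (r′ , ℕₚ.n≢0⇒n>0 w′≢0 , w′) e≢e′ eq) i

  wt≤2 : ∀ e p q → (∀ i → i ≢ p → i ≢ q → e i ≡ + 0) → wt e ≤ 2
  wt≤2 e p q support = begin
    wt e                                                  ≡⟨ countFin≡∑ n _ _ ⟩
    ∑[ i ∈ allFin n ] 𝟙 (¬? (e i ℤ.≟ + 0))                ≤⟨ ∑-mono (allFin n) (λ i _ → at i) ⟩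
    ∑[ i ∈ allFin n ] (𝟙 (i Fin.≟ p) + 𝟙 (i Fin.≟ q))      ≡⟨ ∑-+ (allFin n) _ _ ⟩
    ∑[ i ∈ allFin n ] 𝟙 (i Fin.≟ p) + ∑[ i ∈ allFin n ] 𝟙 (i Fin.≟ q)
                                                          ≤⟨ ℕₚ.+-mono-≤ (atMostOne p) (atMostOne q) ⟩
    2                                                     ∎
    where
    open ℕₚ.≤-Reasoning
    at : ∀ i → 𝟙 (¬? (e i ℤ.≟ + 0)) ≤ 𝟙 (i Fin.≟ p) + 𝟙 (i Fin.≟ q)
    at i with i Fin.≟ p | i Fin.≟ q
    ... | yes _   | i≟q     = ℕₚ.≤-trans (𝟙≤1 (¬? (e i ℤ.≟ + 0))) (ℕₚ.m≤m+n 1 (𝟙 i≟q))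
    ... | no  _   | yes _   = 𝟙≤1 (¬? (e i ℤ.≟ + 0))
    ... | no  i≢p | no  i≢q = ℕₚ.≤-reflexive (𝟙-no (¬? (e i ℤ.≟ + 0)) (λ ei≢0 → ei≢0 (support i i≢p i≢q)))
    atMostOne : ∀ r → ∑[ i ∈ allFin n ] 𝟙 (i Fin.≟ r) ≤ 1
    atMostOne r = ∑-𝟙≤1 (Fin._≟ r) (Uniqueₚ.allFin⁺ n) (λ i j _ _ i≡r j≡r → ≡.trans i≡r (≡.sym j≡r))

  single : Fin n → ℤ → Fin n → ℤ
  single p a i with i Fin.≟ p
  ... | yes _ = a
  ... | no  _ = + 0

  single-at : ∀ p a → single p a p ≡ a
  single-at p a with p Fin.≟ p
  ... | yes _   = refl
  ... | no  p≢p = ⊥-elim (p≢p refl)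

  single-off : ∀ p a i → i ≢ p → single p a i ≡ + 0
  single-off p a i i≢p with i Fin.≟ p
  ... | yes i≡p = ⊥-elim (i≢p i≡p)
  ... | no  _   = refl

  single-range : ∀ p {a} → InRange a → ∀ i → InRange (single p a i)
  single-range p a∈ i with i Fin.≟ p
  ... | yes _ = a∈
  ... | no  _ = 0∈range

  lin-single : ∀ p a → lin (single p a) s ≈ a ·ℤ s p
  lin-single p a = ≈-trans (sumG-single p (λ i i≢p → reflexive (cong (_·ℤ s i) (single-off p a i i≢p))))
                           (reflexive (cong (_·ℤ s p) (single-at p a)))

  ·ℤ-injective : ∀ p {a a′} → InRange a → InRange a′ → a ·ℤ s p ≈ a′ ·ℤ s p → a ≡ a′
  ·ℤ-injective p {a} {a′} a∈ a′∈ eq = begin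
    a              ≡⟨ ≡.sym (single-at p a) ⟩
    single p a p   ≡⟨ lin-injective (single-range p a∈) (wt≤2 _ p p (λ i i≢p _ → single-off p a i i≢p))
                                    (single-range p a′∈) (wt≤2 _ p p (λ i i≢p _ → single-off p a′ i i≢p))
                                    (≈-trans (lin-single p a) (≈-trans eq (≈-sym (lin-single p a′)))) p ⟩
    single p a′ p  ≡⟨ single-at p a′ ⟩
    a′             ∎
    where open ≡.≡-Reasoning

  pair : Fin n → ℤ → Fin n → ℤ → Fin n → ℤ
  pair p a q b i with i Fin.≟ p | i Fin.≟ q
  ... | yes _ | _     = a
  ... | no  _ | yes _ = b
  ... | no  _ | no  _ = + 0

  module _ {p q : Fin n} (p≢q : p ≢ q) (a b : ℤ) where

    pair-at-p : pair p a q b p ≡ a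
    pair-at-p with p Fin.≟ p
    ... | yes _   = refl
    ... | no  p≢p = ⊥-elim (p≢p refl)

    pair-at-q : pair p a q b q ≡ b
    pair-at-q with q Fin.≟ p | q Fin.≟ q
    ... | yes q≡p | _       = ⊥-elim (p≢q (≡.sym q≡p))
    ... | no  _   | yes _   = refl
    ... | no  _   | no  q≢q = ⊥-elim (q≢q refl)

    pair-off : ∀ i → i ≢ p → i ≢ q → pair p a q b i ≡ + 0
    pair-off i i≢p i≢q with i Fin.≟ p | i Fin.≟ q
    ... | yes i≡p | _       = ⊥-elim (i≢p i≡p)
    ... | no  _   | yes i≡q = ⊥-elim (i≢q i≡q)
    ... | no  _   | no  _   = refl

    pair-range : InRange a → InRange b → ∀ i → InRange (pair p a q b i)
    pair-range a∈ b∈ i with i Fin.≟ p | i Fin.≟ q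
    ... | yes _ | _     = a∈
    ... | no  _ | yes _ = b∈
    ... | no  _ | no  _ = 0∈range

    lin-pair : lin (pair p a q b) s ≈ a ·ℤ s p ∙ b ·ℤ s q
    lin-pair = ≈-trans (sumG-cong split)
      (≈-trans (sumG-∙ (λ i → single p a i ·ℤ s i) (λ i → single q b i ·ℤ s i))
               (∙-cong (lin-single p a) (lin-single q b)))
      where
      split : ∀ i → pair p a q b i ·ℤ s i ≈ single p a i ·ℤ s i ∙ single q b i ·ℤ s i
      split i with i Fin.≟ p | i Fin.≟ q
      ... | yes i≡p | yes i≡q = ⊥-elim (p≢q (≡.trans (≡.sym i≡p) i≡q))
      ... | yes _   | no  _   = ≈-sym (identityʳ _)
      ... | no  _   | yes _   = ≈-sym (identityˡ _)
      ... | no  _   | no  _   = ≈-sym (identityˡ _)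

  pair-injective : ∀ {p q} → p ≢ q → ∀ {a b a′ b′} → InRange a → InRange b → InRange a′ → InRange b′ →
                   a ·ℤ s p ∙ b ·ℤ s q ≈ a′ ·ℤ s p ∙ b′ ·ℤ s q → a ≡ a′ × b ≡ b′
  pair-injective {p} {q} p≢q {a} {b} {a′} {b′} a∈ b∈ a′∈ b′∈ eq =
    ≡.trans (≡.sym (pair-at-p p≢q a b)) (≡.trans (same p) (pair-at-p p≢q a′ b′)) ,
    ≡.trans (≡.sym (pair-at-q p≢q a b)) (≡.trans (same q) (pair-at-q p≢q a′ b′))
    where
    same : ∀ i → pair p a q b i ≡ pair p a′ q b′ i
    same = lin-injective (pair-range p≢q a b a∈ b∈) (wt≤2 _ p q (pair-off p≢q a b))
                         (pair-range p≢q a′ b′ a′∈ b′∈) (wt≤2 _ p q (pair-off p≢q a′ b′))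
                         (≈-trans (lin-pair p≢q a b) (≈-trans eq (≈-sym (lin-pair p≢q a′ b′))))

-- With m = k + 2, the coefficient range [1 - m, m] of the paper is [-[1+ k ], + m].
module Coefficients (k : ℕ) where

  m : ℕ
  m = suc (suc k)

  a₀ : ℕ
  a₀ = suc k + suc k

  A₀ A : List ℤ
  A₀ = map -[1+_] (upTo (suc k)) ++ map (λ j → + suc j) (upTo (suc k))
  A  = A₀ ++ + m ∷ []

  data A₀-view : ℤ → Set where
    neg : ∀ {j} → j ≤ k → A₀-view -[1+ j ]
    pos : ∀ {j} → j ≤ k → A₀-view (+ suc j)

  A₀-view⁺ : ∀ {z} → z ∈ A₀ → A₀-view z
  A₀-view⁺ z∈ with ∈-++⁻ (map -[1+_] (upTo (suc k))) z∈
  ... | inj₁ z∈neg with ∈-map⁻ -[1+_] z∈neg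
  ...   | j , j∈ , refl = neg (ℕₚ.≤-pred (∈-upTo⁻ j∈))
  A₀-view⁺ z∈ | inj₂ z∈pos with ∈-map⁻ (λ j → + suc j) z∈pos
  ...   | j , j∈ , refl = pos (ℕₚ.≤-pred (∈-upTo⁻ j∈))

  A₀-neg : ∀ {z} → z ∈ A₀ → ℤ.- z ∈ A₀
  A₀-neg z∈ with A₀-view⁺ z∈
  ... | neg j≤k = ∈-++⁺ʳ (map -[1+_] (upTo (suc k))) (∈-map⁺ (λ j → + suc j) (∈-upTo⁺ (s≤s j≤k)))
  ... | pos j≤k = ∈-++⁺ˡ (∈-map⁺ -[1+_] (∈-upTo⁺ (s≤s j≤k)))

  A₀-≢m : ∀ {z} → z ∈ A₀ → z ≢ + m
  A₀-≢m z∈ z≡m with A₀-view⁺ z∈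
  A₀-≢m z∈ refl | pos j≤k = ℕₚ.1+n≰n j≤k

  m≢-A₀ : ∀ {z} → z ∈ A₀ → + m ≢ ℤ.- z
  m≢-A₀ z∈ m≡-z = A₀-≢m (A₀-neg z∈) (≡.sym m≡-z)

  A₀⊆A : ∀ {z} → z ∈ A₀ → z ∈ A
  A₀⊆A = ∈-++⁺ˡ

  m∈A : + m ∈ A
  m∈A = ∈-++⁺ʳ A₀ (here refl)

  A-cases : ∀ {z} → z ∈ A → z ∈ A₀ ⊎ z ≡ + m
  A-cases z∈ with ∈-++⁻ A₀ z∈
  ... | inj₁ z∈A₀       = inj₁ z∈A₀
  ... | inj₂ (here z≡m) = inj₂ z≡m

  A₀-unique : Unique A₀
  A₀-unique = Uniqueₚ.++⁺ (Uniqueₚ.map⁺ (λ { refl → refl }) (Uniqueₚ.upTo⁺ (suc k)))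
                          (Uniqueₚ.map⁺ (λ { refl → refl }) (Uniqueₚ.upTo⁺ (suc k)))
                          λ (z∈neg , z∈pos) → neg≢pos (∈-map⁻ -[1+_] z∈neg) (∈-map⁻ (λ j → + suc j) z∈pos)
    where
    neg≢pos : ∀ {z} → ∃[ i ] i ∈ upTo (suc k) × z ≡ -[1+ i ] → ∃[ j ] j ∈ upTo (suc k) × z ≡ + suc j → ⊥
    neg≢pos (_ , _ , refl) (_ , _ , ())

  A-unique : Unique A
  A-unique = Uniqueₚ.++⁺ A₀-unique (All.[] ∷ []) λ { (z∈A₀ , here z≡m) → A₀-≢m z∈A₀ z≡m }

  length-A₀ : length A₀ ≡ a₀
  length-A₀ = ≡.trans (length-++ (map -[1+_] (upTo (suc k))))
    (cong₂ _+_ (≡.trans (length-map -[1+_] (upTo (suc k))) (length-upTo (suc k)))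
               (≡.trans (length-map (λ j → + suc j) (upTo (suc k))) (length-upTo (suc k))))

  ∑-A : ∀ f → ∑ A f ≡ ∑ A₀ f + f (+ m)
  ∑-A f = ≡.trans (∑-++ A₀ (+ m ∷ []) f) (cong (_+_ (∑ A₀ f)) (ℕₚ.+-identityʳ (f (+ m))))

  ∑-A₀-1 : ∑[ β ∈ A₀ ] 1 ≡ a₀
  ∑-A₀-1 = ≡.trans (∑-const A₀ 1) (≡.trans (ℕₚ.*-identityʳ (length A₀)) length-A₀)

  split-below-2m : ∀ j → 1 ≤ j → j < 2 * m → ∃[ a ] ∃[ b ] j ≡ suc a + b × suc a ≤ m × b < m
  split-below-2m (suc a) _ j<2m with suc a ℕ.≤? m
  ... | yes 1+a≤m = a , 0 , ≡.sym (ℕₚ.+-identityʳ (suc a)) , 1+a≤m , s≤s z≤n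
  ... | no  1+a≰m = suc k , suc a ℕ.∸ m , ≡.sym (ℕₚ.m+[n∸m]≡n m≤1+a) , ℕₚ.≤-refl ,
                    subst (suc a ℕ.∸ m <_) (≡.trans (ℕₚ.m+n∸m≡n m (m + 0)) (ℕₚ.+-identityʳ m)) (ℕₚ.∸-monoˡ-< j<2m m≤1+a)
    where
    m≤1+a : m ≤ suc a
    m≤1+a = ℕₚ.<⇒≤ (ℕₚ.≰⇒> 1+a≰m)

module Cancellation {c ℓ} (G : FiniteAbelianGroup c ℓ) (k : ℕ) {n : ℕ}
                    (s : Fin n → FiniteAbelianGroup.Carrier G) (D : FAG.Diamond G -[1+ k ] (+ suc (suc k)) 2 s) where

  open FiniteAbelianGroup G renaming (refl to ≈-refl; sym to ≈-sym; trans to ≈-trans)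
  open FAG G
  open GroupProperties G
  open Injectivity G ℤ.-≤+ (ℤ.+≤+ z≤n) s D public
  open Coefficients k public
  open import Algebra.Properties.AbelianGroup abGroup
  open import Relation.Binary.Reasoning.Setoid setoid

  A₀-range : ∀ {z} → z ∈ A₀ → InRange z
  A₀-range z∈ with A₀-view⁺ z∈
  ... | neg j≤k = ℤ.-≤- j≤k , ℤ.-≤+
  ... | pos j≤k = ℤ.-≤+ , ℤ.+≤+ (s≤s (ℕₚ.m≤n⇒m≤1+n j≤k))

  A₀-neg-range : ∀ {z} → z ∈ A₀ → InRange (ℤ.- z)
  A₀-neg-range = A₀-range ∘ A₀-neg

  m-range : InRange (+ m)
  m-range = ℤ.-≤+ , ℤₚ.≤-refl

  A-range : ∀ {z} → z ∈ A → InRange z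
  A-range z∈ with A-cases z∈
  ... | inj₁ z∈A₀ = A₀-range z∈A₀
  ... | inj₂ refl = m-range

  cancel-single : ∀ q {a b} → InRange a → InRange (ℤ.- b) → a ·ℤ s q ∙ b ·ℤ s q ≈ ε → a ≡ ℤ.- b
  cancel-single q {a} {b} a∈ -b∈ sum≈ε =
    ·ℤ-injective q a∈ -b∈ (≈-trans (inverseˡ-unique _ _ sum≈ε) (≈-sym (·ℤ-neg b (s q))))

  cancel-pair : ∀ {p q} → p ≢ q → ∀ {a b c d} → InRange a → InRange (ℤ.- b) → InRange c → InRange (ℤ.- d) →
                a ·ℤ s p ∙ b ·ℤ s p ≈ c ·ℤ s q ∙ d ·ℤ s q → a ≡ ℤ.- b × c ≡ ℤ.- d
  cancel-pair {p} {q} p≢q {a} {b} {c} {d} a∈ -b∈ c∈ -d∈ eq with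
    pair-injective p≢q a∈ -d∈ -b∈ c∈ (begin
      a ·ℤ s p ∙ (ℤ.- d) ·ℤ s q      ≈⟨ ∙-congˡ (·ℤ-neg d (s q)) ⟩
      a ·ℤ s p ∙ (d ·ℤ s q) ⁻¹       ≈⟨ ∙≈∙⇒∙⁻¹≈∙⁻¹ eq ⟩
      c ·ℤ s q ∙ (b ·ℤ s p) ⁻¹       ≈⟨ comm _ _ ⟩
      (b ·ℤ s p) ⁻¹ ∙ c ·ℤ s q       ≈⟨ ∙-congʳ (≈-sym (·ℤ-neg b (s p))) ⟩
      (ℤ.- b) ·ℤ s p ∙ c ·ℤ s q      ∎)
  ... | a≡-b , -d≡c = a≡-b , ≡.sym -d≡c

  pos-range : ∀ {a} → a ≤ m → InRange (+ a)
  pos-range a≤m = ℤ.-≤+ , ℤ.+≤+ a≤m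

  neg-range : ∀ {b} → b < m → InRange (ℤ.- + b)
  neg-range {zero}  _             = 0∈range
  neg-range {suc b} (s≤s (s≤s b≤k)) = ℤ.-≤- b≤k , ℤ.-≤+

  +suc≢-+ : ∀ a b → + suc a ≢ ℤ.- + b
  +suc≢-+ a zero    ()
  +suc≢-+ a (suc b) ()

  nonzero-multiple : ∀ p j → 1 ≤ j → j < 2 * m → ¬ j · s p ≈ ε
  nonzero-multiple p j 1≤j j<2m jx≈ε with split-below-2m j 1≤j j<2m
  ... | a , b , refl , 1+a≤m , b<m =
    +suc≢-+ a b (cancel-single p (pos-range 1+a≤m) (neg-range b<m) (≈-trans (≈-sym (·-+ (suc a) b (s p))) jx≈ε))

  distinct-multiples : ∀ {p q} → p ≢ q → ∀ j → 1 ≤ j → j < 2 * m → ¬ j · s p ≈ j · s q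
  distinct-multiples {p} {q} p≢q j 1≤j j<2m jxp≈jxq with split-below-2m j 1≤j j<2m
  ... | a , b , refl , 1+a≤m , b<m =
    +suc≢-+ a b (proj₁ (cancel-pair p≢q (pos-range 1+a≤m) (neg-range b<m) (pos-range 1+a≤m) (neg-range b<m)
      (≈-trans (≈-sym (·-+ (suc a) b (s p))) (≈-trans jxp≈jxq (·-+ (suc a) b (s q))))))

  hasOrder-2m : ∀ p → (2 * m) · s p ≈ ε → HasOrder (2 * m) (s p)
  hasOrder-2m p 2mx≈ε = 2mx≈ε , λ j 1≤j → nonzero-multiple p (toℕ j) 1≤j (Finₚ.toℕ<n j)

  hasOrder-2m-difference : ∀ {p q} → p ≢ q → (2 * m) · s p ≈ (2 * m) · s q → HasOrder (2 * m) (s p ∙ s q ⁻¹)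
  hasOrder-2m-difference {p} {q} p≢q 2mxp≈2mxq =
    ≈-trans (·-∙⁻¹ (2 * m) (s p) (s q)) (x≈y⇒x∙y⁻¹≈ε 2mxp≈2mxq) ,
    λ j 1≤j jd≈ε → distinct-multiples p≢q (toℕ j) 1≤j (Finₚ.toℕ<n j)
                     (x∙y⁻¹≈ε⇒x≈y _ _ (≈-trans (≈-sym (·-∙⁻¹ (toℕ j) (s p) (s q))) jd≈ε))

  hasOrder-2-half : ∀ p → (2 * m) · s p ≈ ε → HasOrder 2 (m · s p)
  hasOrder-2-half p 2mx≈ε = ≈-trans (∙-congˡ (identityʳ _)) (≈-trans (≈-sym (·-double m (s p))) 2mx≈ε) , nonzero
    where
    nonzero : ∀ (j : Fin 2) → 1 ≤ toℕ j → ¬ toℕ j · (m · s p) ≈ ε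
    nonzero (Fin.suc Fin.zero) _ mx≈ε =
      nonzero-multiple p m (s≤s z≤n) (ℕₚ.m<m+n m (s≤s z≤n)) (≈-trans (≈-sym (identityʳ _)) mx≈ε)

  m·-injective : ∀ {p q} → m · s p ≈ m · s q → p ≡ q
  m·-injective {p} {q} mxp≈mxq with p Fin.≟ q
  ... | yes p≡q = p≡q
  ... | no  p≢q with pair-injective p≢q m-range 0∈range 0∈range m-range
                       (≈-trans (identityʳ _) (≈-trans mxp≈mxq (≈-sym (identityˡ _))))
  ...   | () , _

  -- What a solution α s_p + δ s_p = γ s_q + β s_q becomes once α = δ = m.
  Balanced : Fin n → Fin n → ℤ → ℤ → Set ℓ
  Balanced p q β γ = (2 * m) · s p ≈ β ·ℤ s q ∙ γ ·ℤ s q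

  balanced? : ∀ p q β γ → Dec (Balanced p q β γ)
  balanced? p q β γ = ((2 * m) · s p) ≟ (β ·ℤ s q ∙ γ ·ℤ s q)

  balanced-unique : ∀ {p q β γ γ′} → γ ∈ A → γ′ ∈ A → Balanced p q β γ → Balanced p q β γ′ → γ ≡ γ′
  balanced-unique {q = q} γ∈ γ′∈ bal bal′ =
    ·ℤ-injective q (A-range γ∈) (A-range γ′∈) (∙-cancelˡ _ _ _ (≈-trans (≈-sym bal) bal′))

  torsion-balanced : ∀ {p q β γ} → (2 * m) · s p ≈ ε → β ∈ A₀ → γ ∈ A → Balanced p q β γ → γ ≡ ℤ.- β
  torsion-balanced {q = q} 2mx≈ε β∈ γ∈ bal =
    cancel-single q (A-range γ∈) (A₀-neg-range β∈) (≈-trans (comm _ _) (≈-trans (≈-sym bal) 2mx≈ε))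

  torsion-not-balanced-m : ∀ {p q γ} → (2 * m) · s p ≈ ε → γ ∈ A₀ → ¬ Balanced p q (+ m) γ
  torsion-not-balanced-m {q = q} 2mx≈ε γ∈ bal =
    m≢-A₀ γ∈ (cancel-single q m-range (A₀-neg-range γ∈) (≈-trans (≈-sym bal) 2mx≈ε))

  BalancedPair : ℤ → ℤ → Set
  BalancedPair β γ = (β ∈ A₀ × γ ∈ A) ⊎ (β ≡ + m × γ ∈ A₀)

  normalise : ∀ r {β γ} → BalancedPair β γ →
              ∃[ u ] ∃[ v ] u ∈ A₀ × v ∈ A × β ·ℤ s r ∙ γ ·ℤ s r ≈ v ·ℤ s r ∙ u ·ℤ s r
  normalise r {β} {γ} (inj₁ (β∈ , γ∈))   = β , γ , β∈ , γ∈ , comm _ _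
  normalise r {β} {γ} (inj₂ (refl , γ∈)) = γ , + m , γ∈ , m∈A , ≈-refl

  -- For q ≢ q′ both right-hand sides are pairs over different generators, so cancel-pair
  -- makes them vanish and 2m s_p = 0.
  balanced-exclusive : ∀ {p q q′ β γ β′ γ′} → ¬ (2 * m) · s p ≈ ε → q ≢ q′ →
                       BalancedPair β γ → BalancedPair β′ γ′ → Balanced p q β γ → Balanced p q′ β′ γ′ → ⊥
  balanced-exclusive {p} {q} {q′} 2mx≉ε q≢q′ bp bp′ bal bal′
    with normalise q bp | normalise q′ bp′
  ... | u , v , u∈ , v∈ , eq | u′ , v′ , u′∈ , v′∈ , eq′
    with cancel-pair q≢q′ (A-range v∈) (A₀-neg-range u∈) (A-range v′∈) (A₀-neg-range u′∈)
                     (≈-trans (≈-sym eq) (≈-trans (≈-sym bal) (≈-trans bal′ eq′)))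
  ... | v≡-u , _ = 2mx≉ε (begin
    (2 * m) · s p               ≈⟨ bal ⟩
    _                           ≈⟨ eq ⟩
    v ·ℤ s q ∙ u ·ℤ s q         ≈⟨ ∙-congʳ (reflexive (cong (_·ℤ s q) v≡-u)) ⟩
    (ℤ.- u) ·ℤ s q ∙ u ·ℤ s q   ≈⟨ ∙-congʳ (·ℤ-neg u (s q)) ⟩
    (u ·ℤ s q) ⁻¹ ∙ u ·ℤ s q    ≈⟨ inverseˡ _ ⟩
    ε                           ∎)

  balanced-m-m : ∀ {p q} → Balanced p q (+ m) (+ m) → (2 * m) · s p ≈ (2 * m) · s q
  balanced-m-m {q = q} bal = ≈-trans bal (≈-sym (·-double m (s q)))

divisible-difference : ∀ {d r r′} → r < d → r′ < d → d ℕ∣.∣ ℤ.∣ + r ℤ.- + r′ ∣ → r ≡ r′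
divisible-difference {d} {r} {r′} r<d r′<d d∣ with ℤ.∣ + r ℤ.- + r′ ∣ in eq
... | zero  = ℤₚ.+-injective (ℤₚ.i-j≡0⇒i≡j _ _ (ℤₚ.∣i∣≡0⇒i≡0 eq))
... | suc _ = ⊥-elim (ℕ∣.>⇒∤ (subst (_< d) eq bound) d∣)
  where
  bound : ℤ.∣ + r ℤ.- + r′ ∣ < d
  bound = ℕₚ.≤-<-trans (subst (_≤ r ℕ.⊔ r′) (cong ℤ.∣_∣ (≡.sym (ℤₚ.m-n≡m⊖n r r′))) (ℤₚ.∣m⊝n∣≤m⊔n r r′))
                       (ℕₚ.⊔-lub r<d r′<d)

i<i+suc : ∀ i l → i ℤ.< i ℤ.+ + suc l
i<i+suc i l = subst (ℤ._< i ℤ.+ + suc l) (ℤₚ.+-identityʳ i) (ℤₚ.+-monoʳ-< i (ℤ.+<+ (s≤s z≤n)))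

rangeℤ-bounds : ∀ a l {t} → t ∈ rangeℤ a l → a ℤ.≤ t × t ℤ.< a ℤ.+ + l
rangeℤ-bounds a (suc l) (here refl) = ℤₚ.≤-refl , i<i+suc a l
rangeℤ-bounds a (suc l) (there t∈) with rangeℤ-bounds (a ℤ.+ + 1) l t∈
... | a+1≤t , t<a+1+l = ℤₚ.≤-trans (ℤₚ.i≤i+j a (+ 1)) a+1≤t , subst (_ ℤ.<_) (ℤₚ.+-assoc a (+ 1) (+ l)) t<a+1+l

rangeℤ-unique : ∀ a l → Unique (rangeℤ a l)
rangeℤ-unique a zero    = []
rangeℤ-unique a (suc l) = All.tabulate a≢ ∷ rangeℤ-unique (a ℤ.+ + 1) l
  where
  a≢ : ∀ {t} → t ∈ rangeℤ (a ℤ.+ + 1) l → a ≢ t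
  a≢ t∈ refl = ℤₚ.<-irrefl refl (ℤₚ.<-≤-trans (i<i+suc a 0) (proj₁ (rangeℤ-bounds (a ℤ.+ + 1) l t∈)))

module Decoding {c ℓ} (G : FiniteAbelianGroup c ℓ) (k n′ : ℕ) where

  open FAG G using (JIdx; fin; ∞; Cong; Jlist)
  open Coefficients k
  open import Data.Integer.DivMod using (_/ℕ_; n%ℕd<d; a≡a%ℕn+[a/ℕn]*n; [n/ℕd]*d≤n; n<s[n/ℕd]*d)
  import Data.Integer.Divisibility.Signed as ℤ∣

  N : ℕ
  N = suc n′

  -- nothing is the index ∞, and just (r , c) stands for c · s_r.
  Point : Set
  Point = Maybe (Fin N × ℤ)

  class : Point → Maybe (Fin N)
  class nothing        = nothing
  class (just (r , _)) = just r

  -- As in sExt: j - 1 = residue j + quotient j · N and s_j = multiplier (quotient j) · s_(residue j).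
  residue : ℤ → Fin N
  residue j = Fin.fromℕ< (n%ℕd<d (j ℤ.- + 1) N)

  quotient : ℤ → ℤ
  quotient j = (j ℤ.- + 1) /ℕ N

  multiplier : ℤ → ℤ
  multiplier (+ q)    = + suc q
  multiplier -[1+ q ] = -[1+ q ]

  decode : JIdx → Point
  decode ∞       = nothing
  decode (fin j) = just (residue j , multiplier (quotient j))

  division : ∀ j → j ℤ.- + 1 ≡ + toℕ (residue j) ℤ.+ quotient j ℤ.* + N
  division j = ≡.trans (a≡a%ℕn+[a/ℕn]*n (j ℤ.- + 1) N)
    (cong (λ r → + r ℤ.+ quotient j ℤ.* + N) (≡.sym (Finₚ.toℕ-fromℕ< (n%ℕd<d (j ℤ.- + 1) N))))

  residue-difference : ∀ a b → + toℕ (residue a) ℤ.- + toℕ (residue b) ≡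
                               (a ℤ.- b) ℤ.- (quotient a ℤ.- quotient b) ℤ.* + N
  residue-difference a b = ≡.sym (begin
    (a ℤ.- b) ℤ.- (qa ℤ.- qb) ℤ.* + N
      ≡⟨ cong (ℤ._- (qa ℤ.- qb) ℤ.* + N) (shift a b) ⟩
    ((a ℤ.- + 1) ℤ.- (b ℤ.- + 1)) ℤ.- (qa ℤ.- qb) ℤ.* + N
      ≡⟨ cong₂ (λ u v → (u ℤ.- v) ℤ.- (qa ℤ.- qb) ℤ.* + N) (division a) (division b) ⟩
    ((ra ℤ.+ qa ℤ.* + N) ℤ.- (rb ℤ.+ qb ℤ.* + N)) ℤ.- (qa ℤ.- qb) ℤ.* + N
      ≡⟨ cancel ra rb qa qb (+ N) ⟩
    ra ℤ.- rb ∎)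
    where
    open ≡.≡-Reasoning
    ra rb qa qb : ℤ
    ra = + toℕ (residue a)
    rb = + toℕ (residue b)
    qa = quotient a
    qb = quotient b
    shift : ∀ a b → a ℤ.- b ≡ (a ℤ.- + 1) ℤ.- (b ℤ.- + 1)
    shift = ℤ-Solver.solve-∀
    cancel : ∀ ra rb qa qb n → ((ra ℤ.+ qa ℤ.* n) ℤ.- (rb ℤ.+ qb ℤ.* n)) ℤ.- (qa ℤ.- qb) ℤ.* n ≡ ra ℤ.- rb
    cancel = ℤ-Solver.solve-∀

  Cong⇒residue≡ : ∀ a b → Cong N (fin a) (fin b) → residue a ≡ residue b
  Cong⇒residue≡ a b N∣a-b = Finₚ.toℕ-injective
    (divisible-difference (Finₚ.toℕ<n (residue a)) (Finₚ.toℕ<n (residue b)) (ℤ∣.∣⇒∣ᵤ N∣ra-rb))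
    where
    N∣ra-rb : + N ℤ∣.∣ (+ toℕ (residue a) ℤ.- + toℕ (residue b))
    N∣ra-rb = subst (+ N ℤ∣.∣_) (≡.sym (residue-difference a b))
      (ℤ∣.∣m∣n⇒∣m-n {m = a ℤ.- b} (ℤ∣.∣ᵤ⇒∣ N∣a-b) (ℤ∣.∣n⇒∣m*n (quotient a ℤ.- quotient b) ℤ∣.∣-refl))

  residue≡⇒Cong : ∀ a b → residue a ≡ residue b → Cong N (fin a) (fin b)
  residue≡⇒Cong a b ra≡rb = ℤ∣.∣⇒∣ᵤ (subst (+ N ℤ∣.∣_) a-b≡ (ℤ∣.∣n⇒∣m*n (quotient a ℤ.- quotient b) ℤ∣.∣-refl))
    where
    a-b≡ : (quotient a ℤ.- quotient b) ℤ.* + N ≡ a ℤ.- b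
    a-b≡ = ≡.sym (ℤₚ.i-j≡0⇒i≡j _ _ (≡.trans (≡.sym (residue-difference a b))
             (≡.trans (cong (λ r → + toℕ r ℤ.- + toℕ (residue b)) ra≡rb) (ℤₚ.+-inverseʳ (+ toℕ (residue b))))))

  Cong⇒class≡ : ∀ t t′ → Cong N t t′ → class (decode t) ≡ class (decode t′)
  Cong⇒class≡ ∞       ∞        _  = refl
  Cong⇒class≡ (fin a) (fin b) a≡b = cong just (Cong⇒residue≡ a b a≡b)

  class≡⇒Cong : ∀ t t′ → class (decode t) ≡ class (decode t′) → Cong N t t′
  class≡⇒Cong ∞       ∞       _    = tt
  class≡⇒Cong (fin a) (fin b) eq   = residue≡⇒Cong a b (Maybeₚ.just-injective eq)

  multiplier-injective : ∀ {u v} → multiplier u ≡ multiplier v → u ≡ v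
  multiplier-injective {+ _}      {+ _}      refl = refl
  multiplier-injective { -[1+ _ ]} { -[1+ _ ]} refl = refl

  decode-injective : ∀ {t t′} → decode t ≡ decode t′ → t ≡ t′
  decode-injective {∞}     {∞}     _  = refl
  decode-injective {fin a} {fin b} eq = cong fin (begin
    a                    ≡⟨ shift a ⟩
    (a ℤ.- + 1) ℤ.+ + 1  ≡⟨ cong (ℤ._+ + 1) a-1≡b-1 ⟩
    (b ℤ.- + 1) ℤ.+ + 1  ≡⟨ ≡.sym (shift b) ⟩
    b                    ∎)
    where
    open ≡.≡-Reasoning
    shift : ∀ j → j ≡ (j ℤ.- + 1) ℤ.+ + 1
    shift = ℤ-Solver.solve-∀
    components : (residue a , multiplier (quotient a)) ≡ (residue b , multiplier (quotient b))
    components = Maybeₚ.just-injective eq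
    a-1≡b-1 : a ℤ.- + 1 ≡ b ℤ.- + 1
    a-1≡b-1 = ≡.trans (division a) (≡.trans
      (cong₂ (λ r q → + toℕ r ℤ.+ q ℤ.* + N) (cong proj₁ components) (multiplier-injective (cong proj₂ components)))
      (≡.sym (division b)))

  pointsOf : Maybe (Fin N) → List Point
  pointsOf nothing  = nothing ∷ []
  pointsOf (just r) = map (λ c → just (r , c)) A

  classes : List (Maybe (Fin N))
  classes = nothing ∷ map just (allFin N)

  points : List Point
  points = concat (map pointsOf classes)

  classes-unique : Unique classes
  classes-unique = All.tabulate nothing∉ ∷ Uniqueₚ.map⁺ Maybeₚ.just-injective (Uniqueₚ.allFin⁺ N)
    where
    nothing∉ : ∀ {κ} → κ ∈ map just (allFin N) → nothing ≢ κ
    nothing∉ κ∈ with ∈-map⁻ just κ∈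
    ... | _ , _ , refl = λ ()

  class-pointsOf : ∀ {κ a} → a ∈ pointsOf κ → class a ≡ κ
  class-pointsOf {nothing} (here refl) = refl
  class-pointsOf {just r}  a∈ with ∈-map⁻ (λ c → just (r , c)) a∈
  ... | _ , _ , refl = refl

  J : List JIdx
  J = Jlist N m

  J-unique : Unique J
  J-unique = All.tabulate ∞∉ ∷ Uniqueₚ.map⁺ (λ { refl → refl }) (rangeℤ-unique _ _)
    where
    ∞∉ : ∀ {t} → t ∈ map fin (rangeℤ _ _) → ∞ ≢ t
    ∞∉ t∈ with ∈-map⁻ fin t∈
    ... | _ , _ , refl = λ ()

  quotient-bounds : ∀ {t} → t ∈ rangeℤ (+ 1 ℤ.- + (N * suc k)) (N * m + N * suc k) →
                    -[1+ k ] ℤ.< ℤ.suc (quotient t) × quotient t ℤ.< + m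
  quotient-bounds {t} t∈ with rangeℤ-bounds _ _ t∈
  ... | lo≤t , t<hi = lower , upper
    where
    open ℤₚ.≤-Reasoning
    L U : ℤ
    L = + (N * suc k)
    U = + (N * m)
    shift-lo : ∀ L → (+ 1 ℤ.- L) ℤ.- + 1 ≡ ℤ.- L
    shift-lo = ℤ-Solver.solve-∀
    shift-hi : ∀ U L → (+ 1 ℤ.- L) ℤ.+ (U ℤ.+ L) ℤ.- + 1 ≡ U
    shift-hi = ℤ-Solver.solve-∀
    -L≤t-1 : ℤ.- L ℤ.≤ t ℤ.- + 1
    -L≤t-1 = subst (ℤ._≤ t ℤ.- + 1) (shift-lo L) (ℤₚ.+-monoˡ-≤ (ℤ.- + 1) lo≤t)
    t-1<U : t ℤ.- + 1 ℤ.< U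
    t-1<U = subst (t ℤ.- + 1 ℤ.<_)
              (≡.trans (cong (λ h → (+ 1 ℤ.- L) ℤ.+ h ℤ.- + 1) (ℤₚ.pos-+ (N * m) (N * suc k))) (shift-hi U L))
              (ℤₚ.+-monoˡ-< (ℤ.- + 1) t<hi)
    upper : quotient t ℤ.< + m
    upper = ℤₚ.*-cancelʳ-<-nonNeg (+ N) (begin-strict
      quotient t ℤ.* + N  ≤⟨ [n/ℕd]*d≤n (t ℤ.- + 1) N ⟩
      t ℤ.- + 1           <⟨ t-1<U ⟩
      U                   ≡⟨ ≡.trans (ℤₚ.pos-* N m) (ℤₚ.*-comm (+ N) (+ m)) ⟩
      + m ℤ.* + N         ∎)
    lower : -[1+ k ] ℤ.< ℤ.suc (quotient t)
    lower = ℤₚ.*-cancelʳ-<-nonNeg (+ N) (begin-strict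
      -[1+ k ] ℤ.* + N          ≡⟨ ≡.sym (ℤₚ.neg-distribˡ-* (+ suc k) (+ N)) ⟩
      ℤ.- (+ suc k ℤ.* + N)     ≡⟨ cong ℤ.-_ (≡.trans (≡.sym (ℤₚ.pos-* (suc k) N)) (cong +_ (ℕₚ.*-comm (suc k) N))) ⟩
      ℤ.- L                     ≤⟨ -L≤t-1 ⟩
      t ℤ.- + 1                 <⟨ n<s[n/ℕd]*d (t ℤ.- + 1) N ⟩
      ℤ.suc (quotient t) ℤ.* + N ∎)

  multiplier∈A : ∀ {q} → -[1+ k ] ℤ.< ℤ.suc q → q ℤ.< + m → multiplier q ∈ A
  multiplier∈A {+ j} _ (ℤ.+<+ (s≤s j≤1+k)) with j ℕ.<? suc k
  ... | yes j<1+k = A₀⊆A (∈-++⁺ʳ (map -[1+_] (upTo (suc k))) (∈-map⁺ (λ i → + suc i) (∈-upTo⁺ j<1+k)))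
  ... | no  j≮1+k rewrite ℕₚ.≤-antisym j≤1+k (ℕₚ.≮⇒≥ j≮1+k) = m∈A
  multiplier∈A { -[1+ zero ]}  _            _ = A₀⊆A (∈-++⁺ˡ (∈-map⁺ -[1+_] (∈-upTo⁺ {suc k} (s≤s z≤n))))
  multiplier∈A { -[1+ suc j ]} (ℤ.-<- j<k) _ = A₀⊆A (∈-++⁺ˡ (∈-map⁺ -[1+_] (∈-upTo⁺ {suc k} (s≤s j<k))))

  decode∈points : ∀ {t} → t ∈ J → decode t ∈ points
  decode∈points (here refl) = here refl
  decode∈points (there t∈) with ∈-map⁻ fin t∈
  ... | j , j∈ , refl with quotient-bounds j∈
  ...   | lower , upper = there (∈-concat⁺′ (∈-map⁺ (λ c → just (residue j , c)) (multiplier∈A lower upper))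
                                            (∈-map⁺ pointsOf (∈-map⁺ just (∈-allFin (residue j)))))

module Casting where

  infixl 6 _⊕_
  infixl 7 _⊗_

  data Poly : Set where
    ⌜_⌝     : ℕ → Poly
    _⊕_ _⊗_ : Poly → Poly → Poly

  ⟦_⟧ℕ : Poly → ℕ
  ⟦ ⌜ a ⌝ ⟧ℕ = a
  ⟦ e ⊕ f ⟧ℕ = ⟦ e ⟧ℕ + ⟦ f ⟧ℕ
  ⟦ e ⊗ f ⟧ℕ = ⟦ e ⟧ℕ * ⟦ f ⟧ℕ

  ⟦_⟧ℤ : Poly → ℤ
  ⟦ ⌜ a ⌝ ⟧ℤ = + a
  ⟦ e ⊕ f ⟧ℤ = ⟦ e ⟧ℤ ℤ.+ ⟦ f ⟧ℤ
  ⟦ e ⊗ f ⟧ℤ = ⟦ e ⟧ℤ ℤ.* ⟦ f ⟧ℤ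

  +⟦⟧ℕ≡⟦⟧ℤ : ∀ e → + ⟦ e ⟧ℕ ≡ ⟦ e ⟧ℤ
  +⟦⟧ℕ≡⟦⟧ℤ ⌜ a ⌝   = refl
  +⟦⟧ℕ≡⟦⟧ℤ (e ⊕ f) = ≡.trans (ℤₚ.pos-+ ⟦ e ⟧ℕ ⟦ f ⟧ℕ) (cong₂ ℤ._+_ (+⟦⟧ℕ≡⟦⟧ℤ e) (+⟦⟧ℕ≡⟦⟧ℤ f))
  +⟦⟧ℕ≡⟦⟧ℤ (e ⊗ f) = ≡.trans (ℤₚ.pos-* ⟦ e ⟧ℕ ⟦ f ⟧ℕ) (cong₂ ℤ._*_ (+⟦⟧ℕ≡⟦⟧ℤ e) (+⟦⟧ℕ≡⟦⟧ℤ f))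

  cast-≤ : ∀ e f → ⟦ e ⟧ℕ ≤ ⟦ f ⟧ℕ → ⟦ e ⟧ℤ ℤ.≤ ⟦ f ⟧ℤ
  cast-≤ e f e≤f = subst₂ ℤ._≤_ (+⟦⟧ℕ≡⟦⟧ℤ e) (+⟦⟧ℕ≡⟦⟧ℤ f) (ℤ.+≤+ e≤f)

module Arithmetic where

  open import Data.Integer using () renaming (_+_ to _+ℤ_; _-_ to _-ℤ_; _*_ to _*ℤ_; _≤_ to _≤ℤ_)

  Bound₁ : ℤ → ℤ → ℤ → ℤ → ℤ
  Bound₁ M N C m₂ =
    (+ 4 *ℤ M *ℤ M -ℤ + 8 *ℤ M +ℤ + 5) *ℤ N *ℤ N
    +ℤ (+ 8 *ℤ M -ℤ + 9) *ℤ N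
    +ℤ + 2 *ℤ C *ℤ C
    +ℤ + 2 *ℤ (+ 2 *ℤ M *ℤ N -ℤ + 3 *ℤ N -ℤ + 2 *ℤ M *ℤ M -ℤ + 2 *ℤ M +ℤ + 6) *ℤ C
    +ℤ + 2 *ℤ (+ 2 *ℤ M -ℤ + 3) *ℤ m₂

  Bound₂ : ℤ → ℤ → ℤ → ℤ
  Bound₂ M N m₂ =
    (+ 2 *ℤ M *ℤ M -ℤ + 4 *ℤ M +ℤ + 2) *ℤ N *ℤ N
    +ℤ (+ 4 *ℤ M -ℤ + 4) *ℤ N
    +ℤ (+ 2 *ℤ M -ℤ + 3) *ℤ m₂

  0≤+ : ∀ n → + 0 ≤ℤ + n
  0≤+ n = ℤ.+≤+ z≤n

  0≤-+ : ∀ {a b} → + 0 ≤ℤ a → + 0 ≤ℤ b → + 0 ≤ℤ a +ℤ b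
  0≤-+ = ℤₚ.+-mono-≤

  0≤-* : ∀ {a b} → + 0 ≤ℤ a → + 0 ≤ℤ b → + 0 ≤ℤ a *ℤ b
  0≤-* {+ a} {+ b} _ _ = subst (+ 0 ≤ℤ_) (ℤₚ.pos-* a b) (ℤ.+≤+ z≤n)

  0≤-diff : ∀ {a b} → a ≤ℤ b → + 0 ≤ℤ b -ℤ a
  0≤-diff = ℤₚ.i≤j⇒0≤j-i

  ≤-from-nonneg-diff : ∀ {a b d} → b -ℤ a ≡ d → + 0 ≤ℤ d → a ≤ℤ b
  ≤-from-nonneg-diff {a} {b} b-a≡d 0≤d = ℤₚ.0≤i-j⇒j≤i (subst (+ 0 ≤ℤ_) (≡.sym b-a≡d) 0≤d)

  0≤slack : ∀ k → + 0 ≤ℤ k → + 0 ≤ℤ + 4 *ℤ k *ℤ k +ℤ + 8 *ℤ k +ℤ + 2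
  0≤slack k 0≤k = 0≤-+ (0≤-+ (0≤-* (0≤-* (0≤+ 4) 0≤k) 0≤k) (0≤-* (0≤+ 8) 0≤k)) (0≤+ 2)

  bound₁ : ∀ (k n C K X m₂ : ℤ) → + 0 ≤ℤ k → + 0 ≤ℤ K → n ≡ C +ℤ K -ℤ + 1 → C ≤ℤ m₂ →
           let N  = + 1 +ℤ n
               a₀ = (+ 1 +ℤ k) +ℤ (+ 1 +ℤ k)
           in X +ℤ C +ℤ K ≤ℤ + 2 *ℤ (N *ℤ a₀ +ℤ C) +ℤ N *ℤ (n *ℤ (a₀ *ℤ a₀))
                              +ℤ + 2 *ℤ (C *ℤ (n *ℤ a₀) +ℤ K *ℤ (+ 1 +ℤ a₀)) +ℤ C *ℤ C +ℤ K *ℤ K →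
           X ≤ℤ Bound₁ (+ 2 +ℤ k) N C m₂
  bound₁ k .(C +ℤ K -ℤ + 1) C K X m₂ 0≤k 0≤K refl C≤m₂ master =
    ≤-from-nonneg-diff (identity k C K X m₂)
      (0≤-+ (0≤-+ (0≤-diff master) (0≤-* 0≤K (0≤slack k 0≤k)))
            (0≤-* (0≤-* (0≤+ 2) (0≤-+ (0≤-* (0≤+ 2) 0≤k) (0≤+ 1))) (0≤-diff C≤m₂)))
    where
    -- Bound₁ is spelled out: the ring solver would treat it as an opaque atom.
    identity : ∀ k C K X m₂ →
      let M  = + 2 +ℤ k
          n  = C +ℤ K -ℤ + 1
          N  = + 1 +ℤ n
          a₀ = (+ 1 +ℤ k) +ℤ (+ 1 +ℤ k)
      in (+ 4 *ℤ M *ℤ M -ℤ + 8 *ℤ M +ℤ + 5) *ℤ N *ℤ N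
         +ℤ (+ 8 *ℤ M -ℤ + 9) *ℤ N
         +ℤ + 2 *ℤ C *ℤ C
         +ℤ + 2 *ℤ (+ 2 *ℤ M *ℤ N -ℤ + 3 *ℤ N -ℤ + 2 *ℤ M *ℤ M -ℤ + 2 *ℤ M +ℤ + 6) *ℤ C
         +ℤ + 2 *ℤ (+ 2 *ℤ M -ℤ + 3) *ℤ m₂
         -ℤ X ≡
         ((+ 2 *ℤ (N *ℤ a₀ +ℤ C) +ℤ N *ℤ (n *ℤ (a₀ *ℤ a₀))
            +ℤ + 2 *ℤ (C *ℤ (n *ℤ a₀) +ℤ K *ℤ (+ 1 +ℤ a₀)) +ℤ C *ℤ C +ℤ K *ℤ K) -ℤ (X +ℤ C +ℤ K))
         +ℤ K *ℤ (+ 4 *ℤ k *ℤ k +ℤ + 8 *ℤ k +ℤ + 2)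
         +ℤ + 2 *ℤ (+ 2 *ℤ k +ℤ + 1) *ℤ (m₂ -ℤ C)
    identity = ℤ-Solver.solve-∀

  bound₂ : ∀ (k n M2 m₂ : ℤ) → + 0 ≤ℤ k → + 0 ≤ℤ n → + 0 ≤ℤ m₂ →
           let N  = + 1 +ℤ n
               a₀ = (+ 1 +ℤ k) +ℤ (+ 1 +ℤ k)
           in + 2 *ℤ M2 ≤ℤ + 2 *ℤ (N *ℤ a₀) +ℤ N *ℤ (n *ℤ (a₀ *ℤ a₀)) +ℤ + 2 *ℤ (N *ℤ (+ 1 +ℤ a₀)) →
           M2 ≤ℤ Bound₂ (+ 2 +ℤ k) N m₂
  bound₂ k n M2 m₂ 0≤k 0≤n 0≤m₂ master = ℤₚ.*-cancelˡ-≤-pos M2 (Bound₂ (+ 2 +ℤ k) (+ 1 +ℤ n) m₂) (+ 2)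
    (≤-from-nonneg-diff (identity k n M2 m₂)
      (0≤-+ (0≤-+ (0≤-diff master) (0≤-* (0≤-+ (0≤+ 1) 0≤n) (0≤slack k 0≤k)))
            (0≤-* (0≤-* (0≤+ 2) (0≤-+ (0≤-* (0≤+ 2) 0≤k) (0≤+ 1))) 0≤m₂)))
    where
    identity : ∀ k n M2 m₂ →
      let M  = + 2 +ℤ k
          N  = + 1 +ℤ n
          a₀ = (+ 1 +ℤ k) +ℤ (+ 1 +ℤ k)
      in + 2 *ℤ ((+ 2 *ℤ M *ℤ M -ℤ + 4 *ℤ M +ℤ + 2) *ℤ N *ℤ N
                 +ℤ (+ 4 *ℤ M -ℤ + 4) *ℤ N
                 +ℤ (+ 2 *ℤ M -ℤ + 3) *ℤ m₂)
         -ℤ + 2 *ℤ M2 ≡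
         ((+ 2 *ℤ (N *ℤ a₀) +ℤ N *ℤ (n *ℤ (a₀ *ℤ a₀)) +ℤ + 2 *ℤ (N *ℤ (+ 1 +ℤ a₀))) -ℤ + 2 *ℤ M2)
         +ℤ N *ℤ (+ 4 *ℤ k *ℤ k +ℤ + 8 *ℤ k +ℤ + 2)
         +ℤ + 2 *ℤ (+ 2 *ℤ k +ℤ + 1) *ℤ m₂
    identity = ℤ-Solver.solve-∀

module Counting {c ℓ} (G : FiniteAbelianGroup c ℓ) (k n′ : ℕ)
                (s : Fin (suc n′) → FiniteAbelianGroup.Carrier G)
                (D : FAG.Diamond G -[1+ k ] (+ suc (suc k)) 2 s) where

  open FiniteAbelianGroup G renaming (refl to ≈-refl; sym to ≈-sym; trans to ≈-trans)
  open FAG G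
  open GroupProperties G
  open Cancellation G k s D
  open Decoding G k n′
  open import Data.Integer.DivMod using (_/ℕ_)

  value : Point → Carrier
  value nothing        = ε
  value (just (r , c)) = c ·ℤ s r

  sExt≡value : ∀ t → sExt N s t ≡ value (decode t)
  sExt≡value ∞       = refl
  sExt≡value (fin j) with (j ℤ.- + 1) /ℕ N
  ... | + _      = refl
  ... | -[1+ _ ] = refl

  Solution : Point → Point → Point → Point → Set ℓ
  Solution a b c d = (class a ≢ class b × class c ≢ class d) ×
                     ((class a ≡ class d × class c ≡ class b) × value a ∙ value b ⁻¹ ≈ value c ∙ value d ⁻¹)

  solution? : ∀ a b c d → Dec (Solution a b c d)
  solution? a b c d =
    (¬? (class a ≟κ class b) ×-dec ¬? (class c ≟κ class d)) ×-dec
    ((class a ≟κ class d ×-dec class c ≟κ class b) ×-dec ((value a ∙ value b ⁻¹) ≟ (value c ∙ value d ⁻¹)))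
    where
    _≟κ_ : DecidableEquality (Maybe (Fin N))
    _≟κ_ = Maybeₚ.≡-dec Fin._≟_

  Quadruples : ℕ
  Quadruples = ∑[ a ∈ points ] ∑[ b ∈ points ] ∑[ c ∈ points ] ∑[ d ∈ points ] 𝟙 (solution? a b c d)

  M2Cond⇒Solution : ∀ i j k l → M2Cond N s ((i , j) , (k , l)) → Solution (decode i) (decode j) (decode k) (decode l)
  M2Cond⇒Solution i j k l ((i≢j , k≢l) , ((i≡l , k≡j) , eq)) =
    ((i≢j ∘ class≡⇒Cong i j) , (k≢l ∘ class≡⇒Cong k l)) ,
    ((Cong⇒class≡ i l i≡l , Cong⇒class≡ k j k≡j) ,
     subst₂ _≈_ (cong₂ (λ u v → u ∙ v ⁻¹) (sExt≡value i) (sExt≡value j))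
                (cong₂ (λ u v → u ∙ v ⁻¹) (sExt≡value k) (sExt≡value l)) eq)

  ∑J≤∑points : ∀ h → ∑[ t ∈ J ] h (decode t) ≤ ∑ points h
  ∑J≤∑points h = ℕₚ.≤-trans (ℕₚ.≤-reflexive (≡.sym (∑-map decode J h)))
    (∑-⊆ h (Uniqueₚ.map⁺ decode-injective J-unique) λ t∈ → decode∈points-of-map t∈)
    where
    decode∈points-of-map : ∀ {a} → a ∈ map decode J → a ∈ points
    decode∈points-of-map a∈ with ∈-map⁻ decode a∈
    ... | _ , t∈ , refl = decode∈points t∈

  ∑J²≤∑points² : ∀ (g : Point → Point → ℕ) →
                 ∑[ i ∈ J ] ∑[ j ∈ J ] g (decode i) (decode j) ≤ ∑[ a ∈ points ] ∑[ b ∈ points ] g a b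
  ∑J²≤∑points² g = ℕₚ.≤-trans (∑-mono J (λ i _ → ∑J≤∑points (g (decode i))))
                               (∑J≤∑points (λ a → ∑[ b ∈ points ] g a b))

  ∑J⁴≤∑points⁴ : ∀ (g : Point → Point → Point → Point → ℕ) →
    ∑[ i ∈ J ] ∑[ j ∈ J ] ∑[ k ∈ J ] ∑[ l ∈ J ] g (decode i) (decode j) (decode k) (decode l) ≤
    ∑[ a ∈ points ] ∑[ b ∈ points ] ∑[ c ∈ points ] ∑[ d ∈ points ] g a b c d
  ∑J⁴≤∑points⁴ g = ℕₚ.≤-trans (∑-mono J (λ i _ → ∑-mono J (λ j _ → ∑J²≤∑points² (g (decode i) (decode j)))))
                               (∑J²≤∑points² (λ a b → ∑[ c ∈ points ] ∑[ d ∈ points ] g a b c d))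

  double-M2≤Quadruples : 2 * M2 N m s ≤ Quadruples
  double-M2≤Quadruples = begin
    2 * M2 N m s
      ≡⟨ twice ⟩
    ∑ (pairs2 JJ) (λ (P , Q) → f P Q + f Q P)
      ≤⟨ ∑-pairs2 JJ f ⟩
    ∑[ P ∈ JJ ] ∑[ Q ∈ JJ ] f P Q
      ≡⟨ ∑-cartesianProduct J J (λ P → ∑[ Q ∈ JJ ] f P Q) ⟩
    ∑[ i ∈ J ] ∑[ j ∈ J ] ∑[ Q ∈ JJ ] f (i , j) Q
      ≡⟨ ∑-cong J (λ i _ → ∑-cong J (λ j _ → ∑-cartesianProduct J J (f (i , j)))) ⟩
    ∑[ i ∈ J ] ∑[ j ∈ J ] ∑[ k ∈ J ] ∑[ l ∈ J ] f (i , j) (k , l)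
      ≤⟨ ∑-mono J (λ i _ → ∑-mono J (λ j _ → ∑-mono J (λ k _ → ∑-mono J (λ l _ →
           𝟙-mono (M2Cond? N s _) (solution? _ _ _ _) (M2Cond⇒Solution i j k l))))) ⟩
    ∑[ i ∈ J ] ∑[ j ∈ J ] ∑[ k ∈ J ] ∑[ l ∈ J ] 𝟙 (solution? (decode i) (decode j) (decode k) (decode l))
      ≤⟨ ∑J⁴≤∑points⁴ (λ a b c d → 𝟙 (solution? a b c d)) ⟩
    Quadruples ∎
    where
    open ℕₚ.≤-Reasoning
    JJ : List (JIdx × JIdx)
    JJ = JJlist N m
    f : JIdx × JIdx → JIdx × JIdx → ℕ
    f P Q = 𝟙 (M2Cond? N s (P , Q))
    symmetric : ∀ P Q → f P Q ≡ f Q P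
    symmetric (i , j) (k , l) = ℕₚ.≤-antisym (𝟙-mono _ _ flip) (𝟙-mono _ _ flip)
      where
      flip : ∀ {i j k l} → M2Cond N s ((i , j) , (k , l)) → M2Cond N s ((k , l) , (i , j))
      flip ((i≢j , k≢l) , ((i≡l , k≡j) , eq)) = (k≢l , i≢j) , ((k≡j , i≡l) , ≈-sym eq)
    count≡ : M2 N m s ≡ ∑ (pairs2 JJ) (λ (P , Q) → f P Q)
    count≡ = countL≡∑ (M2Cond N s) (M2Cond? N s) (pairs2 JJ)
    twice : 2 * M2 N m s ≡ ∑ (pairs2 JJ) (λ (P , Q) → f P Q + f Q P)
    twice = begin-equality
      2 * M2 N m s                                    ≡⟨ cong (_+_ (M2 N m s)) (ℕₚ.+-identityʳ _) ⟩
      M2 N m s + M2 N m s                             ≡⟨ cong₂ _+_ count≡ count≡ ⟩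
      ∑ (pairs2 JJ) (λ (P , Q) → f P Q) + ∑ (pairs2 JJ) (λ (P , Q) → f P Q)
        ≡⟨ ≡.sym (∑-+ (pairs2 JJ) (λ (P , Q) → f P Q) (λ (P , Q) → f P Q)) ⟩
      ∑ (pairs2 JJ) (λ (P , Q) → f P Q + f P Q)
        ≡⟨ ∑-cong (pairs2 JJ) (λ (P , Q) _ → cong (_+_ (f P Q)) (symmetric P Q)) ⟩
      ∑ (pairs2 JJ) (λ (P , Q) → f P Q + f Q P)       ∎

  ∑points≡∑classes : ∀ h → ∑ points h ≡ ∑[ κ ∈ classes ] ∑ (pointsOf κ) h
  ∑points≡∑classes h = ≡.trans (∑-concat (map pointsOf classes) h) (∑-map pointsOf classes (λ ps → ∑ ps h))

  ∑points-restrict : ∀ κ h → (∀ a → h a ≢ 0 → class a ≡ κ) → ∑ points h ≤ ∑ (pointsOf κ) h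
  ∑points-restrict κ h only-κ = ℕₚ.≤-trans (ℕₚ.≤-reflexive (∑points≡∑classes h))
    (∑-single κ classes-unique λ κ′ _ ∑≢0 → witness κ′ (∑-nonzero (pointsOf κ′) ∑≢0))
    where
    witness : ∀ κ′ → ∃[ a ] a ∈ pointsOf κ′ × h a ≢ 0 → κ′ ≡ κ
    witness κ′ (a , a∈ , ha≢0) = ≡.trans (≡.sym (class-pointsOf a∈)) (only-κ a ha≢0)

  ClassPair : Maybe (Fin N) → Maybe (Fin N) → ℕ
  ClassPair κ λ′ =
    ∑[ a ∈ pointsOf κ ] ∑[ b ∈ pointsOf λ′ ] ∑[ c ∈ pointsOf λ′ ] ∑[ d ∈ pointsOf κ ] 𝟙 (solution? a b c d)

  Quadruples≤∑ClassPair : Quadruples ≤ ∑[ κ ∈ classes ] ∑[ λ′ ∈ classes ] ClassPair κ λ′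
  Quadruples≤∑ClassPair = begin
    Quadruples
      ≤⟨ ∑-mono points (λ a _ → ∑-mono points (λ b _ → restrict a b)) ⟩
    ∑[ a ∈ points ] ∑[ b ∈ points ] F a b
      ≡⟨ ∑points≡∑classes (λ a → ∑[ b ∈ points ] F a b) ⟩
    ∑[ κ ∈ classes ] ∑[ a ∈ pointsOf κ ] ∑[ b ∈ points ] F a b
      ≡⟨ ∑-cong classes (λ κ _ → ∑-cong (pointsOf κ) (λ a _ → ∑points≡∑classes (F a))) ⟩
    ∑[ κ ∈ classes ] ∑[ a ∈ pointsOf κ ] ∑[ λ′ ∈ classes ] ∑[ b ∈ pointsOf λ′ ] F a b
      ≡⟨ ∑-cong classes (λ κ _ → ∑-swap (pointsOf κ) classes (λ a λ′ → ∑[ b ∈ pointsOf λ′ ] F a b)) ⟩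
    ∑[ κ ∈ classes ] ∑[ λ′ ∈ classes ] ∑[ a ∈ pointsOf κ ] ∑[ b ∈ pointsOf λ′ ] F a b
      ≡⟨ ∑-cong classes (λ κ _ → ∑-cong classes (λ λ′ _ →
           ∑-cong (pointsOf κ) (λ a a∈ → ∑-cong (pointsOf λ′) (λ b b∈ → F≡ κ λ′ a∈ b∈)))) ⟩
    ∑[ κ ∈ classes ] ∑[ λ′ ∈ classes ] ClassPair κ λ′ ∎
    where
    open ℕₚ.≤-Reasoning
    F : Point → Point → ℕ
    F a b = ∑[ c ∈ pointsOf (class b) ] ∑[ d ∈ pointsOf (class a) ] 𝟙 (solution? a b c d)
    F≡ : ∀ κ λ′ {a b} → a ∈ pointsOf κ → b ∈ pointsOf λ′ →
         F a b ≡ ∑[ c ∈ pointsOf λ′ ] ∑[ d ∈ pointsOf κ ] 𝟙 (solution? a b c d)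
    F≡ κ λ′ {a} {b} a∈ b∈ = cong₂ (λ κa κb → ∑[ c ∈ pointsOf κb ] ∑[ d ∈ pointsOf κa ] 𝟙 (solution? a b c d))
                                  (class-pointsOf {κ} a∈) (class-pointsOf {λ′} b∈)
    restrict : ∀ a b → ∑[ c ∈ points ] ∑[ d ∈ points ] 𝟙 (solution? a b c d) ≤ F a b
    restrict a b = ℕₚ.≤-trans
      (∑-mono points (λ c _ → ∑points-restrict (class a) (λ d → 𝟙 (solution? a b c d))
        (λ d nz → ≡.sym (proj₁ (proj₁ (proj₂ (𝟙≢0⇒ (solution? a b c d) nz)))))))
      (∑points-restrict (class b) (λ c → ∑[ d ∈ pointsOf (class a) ] 𝟙 (solution? a b c d))
        (λ c nz → c-class c (∑-nonzero (pointsOf (class a)) nz)))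
      where
      c-class : ∀ c → ∃[ d ] d ∈ pointsOf (class a) × 𝟙 (solution? a b c d) ≢ 0 → class c ≡ class b
      c-class c (d , _ , nz) = proj₂ (proj₁ (proj₂ (𝟙≢0⇒ (solution? a b c d) nz)))

  solution⇒equation : ∀ a b c d → Solution a b c d → value a ∙ value d ≈ value c ∙ value b
  solution⇒equation _ _ _ _ sol = ∙⁻¹≈∙⁻¹⇒∙≈∙ (proj₂ (proj₂ sol))

  ClassPair-diagonal : ∀ κ → ClassPair κ κ ≡ 0
  ClassPair-diagonal κ = ∑-zero (pointsOf κ) λ a a∈ → ∑-zero (pointsOf κ) λ b b∈ →
    ∑-zero (pointsOf κ) λ c _ → ∑-zero (pointsOf κ) λ d _ → 𝟙-no (solution? a b c d)
      λ sol → proj₁ (proj₁ sol) (≡.trans (class-pointsOf {κ} a∈) (≡.sym (class-pointsOf {κ} b∈)))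

  Torsion : Fin N → ℕ
  Torsion q = 𝟙 (((2 * m) · s q) ≟ ε)

  vanishing-pairs≤ : ∀ q {p} {P : ℤ → ℤ → Set p} (P? : ∀ β γ → Dec (P β γ)) →
                   (∀ β γ → P β γ → β ·ℤ s q ∙ γ ·ℤ s q ≈ ε) →
                   ∑[ β ∈ A ] ∑[ γ ∈ A ] 𝟙 (P? β γ) ≤ a₀ + Torsion q
  vanishing-pairs≤ q {P = P} P? sum≈ε = begin
    ∑[ β ∈ A ] ∑[ γ ∈ A ] 𝟙 (P? β γ)                    ≡⟨ ∑-A (λ β → ∑[ γ ∈ A ] 𝟙 (P? β γ)) ⟩
    ∑[ β ∈ A₀ ] ∑[ γ ∈ A ] 𝟙 (P? β γ) + ∑[ γ ∈ A ] 𝟙 (P? (+ m) γ)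
      ≤⟨ ℕₚ.+-mono-≤ (∑-mono A₀ (λ β β∈ → ℕₚ.≤-trans (∑-mono A (λ γ γ∈ → 𝟙-mono (P? β γ) (γ ℤ.≟ ℤ.- β) (is-neg β∈ γ∈)))
                                                     (∑-𝟙-≟≤1 ℤ._≟_ A-unique (ℤ.- β))))
                     (∑-atMostOne (Torsion q) A-unique (λ γ γ∈ → 𝟙-mono (P? (+ m) γ) _ (torsion γ∈))
                        (λ γ γ′ γ∈ γ′∈ nz nz′ → ≡.trans (is-m γ∈ (𝟙≢0⇒ (P? (+ m) γ) nz))
                                                       (≡.sym (is-m γ′∈ (𝟙≢0⇒ (P? (+ m) γ′) nz′))))) ⟩
    ∑[ β ∈ A₀ ] 1 + Torsion q                            ≡⟨ cong (_+ Torsion q) ∑-A₀-1 ⟩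
    a₀ + Torsion q                                       ∎
    where
    open ℕₚ.≤-Reasoning
    is-neg : ∀ {β γ} → β ∈ A₀ → γ ∈ A → P β γ → γ ≡ ℤ.- β
    is-neg β∈ γ∈ pβγ = cancel-single q (A-range γ∈) (A₀-neg-range β∈) (≈-trans (comm _ _) (sum≈ε _ _ pβγ))
    is-m : ∀ {γ} → γ ∈ A → P (+ m) γ → γ ≡ + m
    is-m γ∈ pmγ with A-cases γ∈
    ... | inj₂ γ≡m  = γ≡m
    ... | inj₁ γ∈A₀ = ⊥-elim (m≢-A₀ γ∈A₀ (cancel-single q m-range (A₀-neg-range γ∈A₀) (sum≈ε _ _ pmγ)))
    torsion : ∀ {γ} → γ ∈ A → P (+ m) γ → (2 * m) · s q ≈ ε
    torsion γ∈ pmγ = ≈-trans (·-double m (s q))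
      (≈-trans (∙-congˡ (reflexive (cong (_·ℤ s q) (≡.sym (is-m γ∈ pmγ))))) (sum≈ε _ _ pmγ))

  ∑-pointsOf-just : ∀ p f → ∑ (pointsOf (just p)) f ≡ ∑[ α ∈ A ] f (just (p , α))
  ∑-pointsOf-just p f = ∑-map (λ c → just (p , c)) A f

  ClassPair-∞-just : ∀ q → ClassPair nothing (just q) ≤ a₀ + Torsion q
  ClassPair-∞-just q = begin
    ClassPair nothing (just q)
      ≡⟨ ℕₚ.+-identityʳ _ ⟩
    ∑ (pointsOf (just q)) (λ b → ∑ (pointsOf (just q)) (λ c → 𝟙 (solution? nothing b c nothing) + 0))
      ≡⟨ ∑-pointsOf-just q (λ b → ∑ (pointsOf (just q)) (λ c → 𝟙 (solution? nothing b c nothing) + 0)) ⟩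
    ∑[ β ∈ A ] ∑ (pointsOf (just q)) (λ c → 𝟙 (solution? nothing (just (q , β)) c nothing) + 0)
      ≡⟨ ∑-cong A (λ β _ → ≡.trans (∑-pointsOf-just q (λ c → 𝟙 (solution? nothing (just (q , β)) c nothing) + 0))
                                   (∑-cong A (λ γ _ → ℕₚ.+-identityʳ _))) ⟩
    ∑[ β ∈ A ] ∑[ γ ∈ A ] 𝟙 (solution? nothing (just (q , β)) (just (q , γ)) nothing)
      ≤⟨ vanishing-pairs≤ q (λ β γ → solution? nothing (just (q , β)) (just (q , γ)) nothing)
           (λ β γ sol → ≈-trans (comm _ _) (≈-trans
              (≈-sym (solution⇒equation nothing (just (q , β)) (just (q , γ)) nothing sol)) (identityˡ ε))) ⟩
    a₀ + Torsion q ∎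
    where open ℕₚ.≤-Reasoning

  ClassPair-just-∞ : ∀ p → ClassPair (just p) nothing ≤ a₀ + Torsion p
  ClassPair-just-∞ p = begin
    ClassPair (just p) nothing
      ≡⟨ ∑-pointsOf-just p (λ a → (∑ (pointsOf (just p)) (λ d → 𝟙 (solution? a nothing nothing d)) + 0) + 0) ⟩
    ∑[ α ∈ A ] ((∑ (pointsOf (just p)) (λ d → 𝟙 (solution? (just (p , α)) nothing nothing d)) + 0) + 0)
      ≡⟨ ∑-cong A (λ α _ → ≡.trans (ℕₚ.+-identityʳ _) (≡.trans (ℕₚ.+-identityʳ _)
           (∑-pointsOf-just p (λ d → 𝟙 (solution? (just (p , α)) nothing nothing d))))) ⟩
    ∑[ α ∈ A ] ∑[ δ ∈ A ] 𝟙 (solution? (just (p , α)) nothing nothing (just (p , δ)))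
      ≤⟨ vanishing-pairs≤ p (λ α δ → solution? (just (p , α)) nothing nothing (just (p , δ)))
           (λ α δ sol → ≈-trans (solution⇒equation (just (p , α)) nothing nothing (just (p , δ)) sol) (identityˡ ε)) ⟩
    a₀ + Torsion p ∎
    where open ℕₚ.≤-Reasoning

  H₁ H₂ H Hₘₘ : Fin N → Fin N → ℕ
  H₁ p q  = ∑[ β ∈ A₀ ] ∑[ γ ∈ A ] 𝟙 (balanced? p q β γ)
  H₂ p q  = ∑[ γ ∈ A₀ ] 𝟙 (balanced? p q (+ m) γ)
  H p q   = H₁ p q + H₂ p q
  Hₘₘ p q = 𝟙 (balanced? p q (+ m) (+ m))

  module _ {p q : Fin N} (p≢q : p ≢ q) where

    sol? : ∀ α β γ δ → Dec (Solution (just (p , α)) (just (q , β)) (just (q , γ)) (just (p , δ)))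
    sol? α β γ δ = solution? (just (p , α)) (just (q , β)) (just (q , γ)) (just (p , δ))

    equation : ∀ α β γ δ → Solution (just (p , α)) (just (q , β)) (just (q , γ)) (just (p , δ)) →
               α ·ℤ s p ∙ δ ·ℤ s p ≈ γ ·ℤ s q ∙ β ·ℤ s q
    equation α β γ δ = solution⇒equation (just (p , α)) (just (q , β)) (just (q , γ)) (just (p , δ))

    Block : ℤ → ℤ → ℕ
    Block α β = ∑[ γ ∈ A ] ∑[ δ ∈ A ] 𝟙 (sol? α β γ δ)

    block-A₀-A₀ : ∀ {α β} → α ∈ A₀ → β ∈ A₀ → Block α β ≤ 1
    block-A₀-A₀ {α} {β} α∈ β∈ = ℕₚ.≤-trans
      (∑∑-𝟙-fibreʳ (sol? α β) (ℤ._≟ ℤ.- β) (ℤ.- α) A-unique λ γ δ γ∈ δ∈ sol →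
        swap (cancel-pair p≢q (A-range δ∈) (A₀-neg-range α∈) (A-range γ∈) (A₀-neg-range β∈)
                          (≈-trans (comm _ _) (equation α β γ δ sol))))
      (∑-𝟙-≟≤1 ℤ._≟_ A-unique (ℤ.- β))

    block-A₀-m : ∀ {α} → α ∈ A₀ → Block α (+ m) ≤ ∑[ δ ∈ A ] 𝟙 (balanced? q p α δ)
    block-A₀-m {α} α∈ = ∑∑-𝟙-fibreˡ (sol? α (+ m)) (balanced? q p α) (+ m) A-unique λ γ δ γ∈ δ∈ sol →
      let γ≡m = is-m γ∈ δ∈ sol in
      γ≡m , ≈-trans (·-double m (s q))
              (≈-trans (∙-congʳ (reflexive (cong (_·ℤ s q) (≡.sym γ≡m)))) (≈-sym (equation α (+ m) γ δ sol)))
      where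
      is-m : ∀ {γ δ} → γ ∈ A → δ ∈ A → Solution (just (p , α)) (just (q , + m)) (just (q , γ)) (just (p , δ)) → γ ≡ + m
      is-m {γ} {δ} γ∈ δ∈ sol with A-cases γ∈
      ... | inj₂ γ≡m  = γ≡m
      ... | inj₁ γ∈A₀ = ⊥-elim (m≢-A₀ γ∈A₀ (proj₂ (cancel-pair p≢q (A-range δ∈) (A₀-neg-range α∈) m-range
                          (A₀-neg-range γ∈A₀) (≈-trans (comm _ _) (≈-trans (equation α (+ m) γ δ sol) (comm _ _))))))

    block-m-A₀ : ∀ {β} → β ∈ A₀ → Block (+ m) β ≤ ∑[ γ ∈ A ] 𝟙 (balanced? p q β γ)
    block-m-A₀ {β} β∈ = ∑∑-𝟙-fibreʳ (sol? (+ m) β) (balanced? p q β) (+ m) A-unique λ γ δ γ∈ δ∈ sol →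
      let δ≡m = is-m γ∈ δ∈ sol in
      ≈-trans (·-double m (s p))
        (≈-trans (∙-congˡ (reflexive (cong (_·ℤ s p) (≡.sym δ≡m)))) (≈-trans (equation (+ m) β γ δ sol) (comm _ _))) ,
      δ≡m
      where
      is-m : ∀ {γ δ} → γ ∈ A → δ ∈ A → Solution (just (p , + m)) (just (q , β)) (just (q , γ)) (just (p , δ)) → δ ≡ + m
      is-m {γ} {δ} γ∈ δ∈ sol with A-cases δ∈
      ... | inj₂ δ≡m  = δ≡m
      ... | inj₁ δ∈A₀ = ⊥-elim (m≢-A₀ δ∈A₀ (proj₁ (cancel-pair p≢q m-range (A₀-neg-range δ∈A₀) (A-range γ∈)
                          (A₀-neg-range β∈) (equation (+ m) β γ δ sol))))

    block-m-m : Block (+ m) (+ m) ≤ ∑[ γ ∈ A ] 𝟙 (balanced? p q (+ m) γ) + H₂ q p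
    block-m-m = begin
      Block (+ m) (+ m)
        ≡⟨ ∑-cong A (λ γ _ → ∑-A (λ δ → 𝟙 (sol? (+ m) (+ m) γ δ))) ⟩
      ∑[ γ ∈ A ] (∑[ δ ∈ A₀ ] 𝟙 (sol? (+ m) (+ m) γ δ) + 𝟙 (sol? (+ m) (+ m) γ (+ m)))
        ≡⟨ ∑-+ A (λ γ → ∑[ δ ∈ A₀ ] 𝟙 (sol? (+ m) (+ m) γ δ)) (λ γ → 𝟙 (sol? (+ m) (+ m) γ (+ m))) ⟩
      ∑[ γ ∈ A ] ∑[ δ ∈ A₀ ] 𝟙 (sol? (+ m) (+ m) γ δ) + ∑[ γ ∈ A ] 𝟙 (sol? (+ m) (+ m) γ (+ m))
        ≤⟨ ℕₚ.+-mono-≤ δ∈A₀-part δ≡m-part ⟩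
      H₂ q p + ∑[ γ ∈ A ] 𝟙 (balanced? p q (+ m) γ)
        ≡⟨ ℕₚ.+-comm (H₂ q p) _ ⟩
      ∑[ γ ∈ A ] 𝟙 (balanced? p q (+ m) γ) + H₂ q p ∎
      where
      open ℕₚ.≤-Reasoning
      δ≡m-part : ∑[ γ ∈ A ] 𝟙 (sol? (+ m) (+ m) γ (+ m)) ≤ ∑[ γ ∈ A ] 𝟙 (balanced? p q (+ m) γ)
      δ≡m-part = ∑-mono A λ γ _ → 𝟙-mono (sol? (+ m) (+ m) γ (+ m)) (balanced? p q (+ m) γ)
        λ sol → ≈-trans (·-double m (s p)) (≈-trans (equation (+ m) (+ m) γ (+ m) sol) (comm _ _))
      δ∈A₀-part : ∑[ γ ∈ A ] ∑[ δ ∈ A₀ ] 𝟙 (sol? (+ m) (+ m) γ δ) ≤ H₂ q p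
      δ∈A₀-part = ∑∑-𝟙-fibreˡ (sol? (+ m) (+ m)) (balanced? q p (+ m)) (+ m) A-unique λ γ δ γ∈ δ∈ sol →
        let γ≡m = is-m γ∈ δ∈ sol in
        γ≡m , ≈-trans (·-double m (s q))
                (≈-trans (∙-congʳ (reflexive (cong (_·ℤ s q) (≡.sym γ≡m)))) (≈-sym (equation (+ m) (+ m) γ δ sol)))
        where
        is-m : ∀ {γ δ} → γ ∈ A → δ ∈ A₀ →
               Solution (just (p , + m)) (just (q , + m)) (just (q , γ)) (just (p , δ)) → γ ≡ + m
        is-m {γ} {δ} γ∈ δ∈ sol with A-cases γ∈
        ... | inj₂ γ≡m  = γ≡m
        ... | inj₁ γ∈A₀ = ⊥-elim (m≢-A₀ δ∈ (proj₁ (cancel-pair p≢q m-range (A₀-neg-range δ∈) m-range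
                            (A₀-neg-range γ∈A₀) (≈-trans (equation (+ m) (+ m) γ δ sol) (comm _ _)))))

    ClassPair-blocks : ClassPair (just p) (just q) ≡ ∑[ α ∈ A ] ∑[ β ∈ A ] Block α β
    ClassPair-blocks = ≡.trans (∑-pointsOf-just p _) (∑-cong A λ α _ →
                       ≡.trans (∑-pointsOf-just q _) (∑-cong A λ β _ →
                       ≡.trans (∑-pointsOf-just q _) (∑-cong A λ γ _ →
                       ∑-pointsOf-just p _)))

    ClassPair-distinct : ClassPair (just p) (just q) ≤ a₀ * a₀ + (H p q + H q p + Hₘₘ p q)
    ClassPair-distinct = begin
      ClassPair (just p) (just q)
        ≡⟨ ClassPair-blocks ⟩
      ∑[ α ∈ A ] ∑[ β ∈ A ] Block α β
        ≡⟨ ∑-cong A (λ α _ → ∑-A (Block α)) ⟩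
      ∑[ α ∈ A ] (∑[ β ∈ A₀ ] Block α β + Block α (+ m))
        ≡⟨ ∑-A (λ α → ∑[ β ∈ A₀ ] Block α β + Block α (+ m)) ⟩
      ∑[ α ∈ A₀ ] (∑[ β ∈ A₀ ] Block α β + Block α (+ m)) + (∑[ β ∈ A₀ ] Block (+ m) β + Block (+ m) (+ m))
        ≤⟨ ℕₚ.+-mono-≤ (∑-mono A₀ (λ α α∈ → ℕₚ.+-mono-≤ (∑-mono A₀ (λ β β∈ → block-A₀-A₀ α∈ β∈)) (block-A₀-m α∈)))
                       (ℕₚ.+-mono-≤ (∑-mono A₀ (λ β β∈ → block-m-A₀ β∈)) block-m-m) ⟩
      ∑[ α ∈ A₀ ] (∑[ β ∈ A₀ ] 1 + ∑[ δ ∈ A ] 𝟙 (balanced? q p α δ)) +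
        (H₁ p q + (∑[ γ ∈ A ] 𝟙 (balanced? p q (+ m) γ) + H₂ q p))
        ≡⟨ cong₂ _+_ (≡.trans (∑-+ A₀ (λ _ → ∑[ β ∈ A₀ ] 1) (λ α → ∑[ δ ∈ A ] 𝟙 (balanced? q p α δ)))
                              (cong (_+ H₁ q p) (≡.trans (∑-const A₀ _) (cong₂ _*_ length-A₀ ∑-A₀-1))))
                     (cong (λ t → H₁ p q + (t + H₂ q p)) (∑-A (λ γ → 𝟙 (balanced? p q (+ m) γ)))) ⟩
      (a₀ * a₀ + H₁ q p) + (H₁ p q + ((H₂ p q + Hₘₘ p q) + H₂ q p))
        ≡⟨ rearrange (a₀ * a₀) (H₁ q p) (H₁ p q) (H₂ p q) (Hₘₘ p q) (H₂ q p) ⟩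
      a₀ * a₀ + (H p q + H q p + Hₘₘ p q) ∎
      where
      open ℕₚ.≤-Reasoning
      rearrange : ∀ a h₁′ h₁ h₂ t h₂′ → (a + h₁′) + (h₁ + ((h₂ + t) + h₂′)) ≡ a + ((h₁ + h₂) + (h₁′ + h₂′) + t)
      rearrange = ℕ-Solver.solve-∀

  C : ℕ
  C = ∑ (allFin N) Torsion

  W : Fin N → Fin N → ℕ
  W p q = a₀ * a₀ + (H p q + H q p + Hₘₘ p q)

  ClassPair-just : ∀ p q → ClassPair (just p) (just q) ≤ [ p ≢ q ] * W p q
  ClassPair-just p q = by-cases (p Fin.≟ q)
    where
    by-cases : Dec (p ≡ q) → ClassPair (just p) (just q) ≤ [ p ≢ q ] * W p q
    by-cases (yes refl) = ℕₚ.≤-trans (ℕₚ.≤-reflexive (ClassPair-diagonal (just p))) z≤n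
    by-cases (no  p≢q)  = ℕₚ.≤-trans (ClassPair-distinct p≢q) (ℕₚ.≤-reflexive
      (≡.trans (≡.sym (ℕₚ.*-identityˡ (W p q))) (cong (_* W p q) (≡.sym (𝟙-yes (¬? (p Fin.≟ q)) p≢q)))))

  ∑-torsion-row : ∑[ q ∈ allFin N ] (a₀ + Torsion q) ≡ N * a₀ + C
  ∑-torsion-row = ≡.trans (∑-+ (allFin N) (λ _ → a₀) Torsion)
    (cong (_+ C) (≡.trans (∑-const (allFin N) a₀) (cong (_* a₀) (length-tabulate {n = N} (λ i → i)))))

  ∑ClassPair≤ : ∑[ κ ∈ classes ] ∑[ λ′ ∈ classes ] ClassPair κ λ′ ≤ 2 * (N * a₀ + C) + ∑≢ N W
  ∑ClassPair≤ = begin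
    ∑[ κ ∈ classes ] ∑[ λ′ ∈ classes ] ClassPair κ λ′
      ≡⟨ cong₂ _+_ (cong₂ _+_ (ClassPair-diagonal nothing) (∑-map just (allFin N) (ClassPair nothing)))
                   (≡.trans (∑-map just (allFin N) (λ κ → ∑[ λ′ ∈ classes ] ClassPair κ λ′))
                            (∑-cong (allFin N) λ p _ → cong (_+_ (ClassPair (just p) nothing))
                                                            (∑-map just (allFin N) (ClassPair (just p))))) ⟩
    ∑[ q ∈ allFin N ] ClassPair nothing (just q) +
      ∑[ p ∈ allFin N ] (ClassPair (just p) nothing + ∑[ q ∈ allFin N ] ClassPair (just p) (just q))
      ≤⟨ ℕₚ.+-mono-≤ (∑-mono (allFin N) (λ q _ → ClassPair-∞-just q))
                     (∑-mono (allFin N) λ p _ → ℕₚ.+-mono-≤ (ClassPair-just-∞ p)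
                                                             (∑-mono (allFin N) (λ q _ → ClassPair-just p q))) ⟩
    ∑[ q ∈ allFin N ] (a₀ + Torsion q) + ∑[ p ∈ allFin N ] (a₀ + Torsion p + ∑[ q ∈ allFin N ] [ p ≢ q ] * W p q)
      ≡⟨ cong (_+_ (∑[ q ∈ allFin N ] (a₀ + Torsion q))) (∑-+ (allFin N) (λ p → a₀ + Torsion p) _) ⟩
    ∑[ q ∈ allFin N ] (a₀ + Torsion q) + (∑[ p ∈ allFin N ] (a₀ + Torsion p) + ∑≢ N W)
      ≡⟨ cong₂ (λ r r′ → r + (r′ + ∑≢ N W)) ∑-torsion-row ∑-torsion-row ⟩
    (N * a₀ + C) + ((N * a₀ + C) + ∑≢ N W)
      ≡⟨ double (N * a₀ + C) (∑≢ N W) ⟩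
    2 * (N * a₀ + C) + ∑≢ N W ∎
    where
    open ℕₚ.≤-Reasoning
    double : ∀ a b → a + (a + b) ≡ 2 * a + b
    double = ℕ-Solver.solve-∀

  ∑≢W : ∑≢ N W ≡ N * (n′ * (a₀ * a₀)) + (2 * ∑≢ N H + ∑≢ N Hₘₘ)
  ∑≢W = begin
    ∑≢ N W
      ≡⟨ ∑≢-+ N (λ _ _ → a₀ * a₀) (λ p q → H p q + H q p + Hₘₘ p q) ⟩
    ∑≢ N (λ _ _ → a₀ * a₀) + ∑≢ N (λ p q → H p q + H q p + Hₘₘ p q)
      ≡⟨ cong₂ _+_ (∑≢-const n′ (a₀ * a₀))
                   (≡.trans (∑≢-+ N (λ p q → H p q + H q p) Hₘₘ)
                            (cong (_+ ∑≢ N Hₘₘ) (≡.trans (∑≢-+ N H (λ p q → H q p))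
                                                         (cong (_+_ (∑≢ N H)) (∑≢-transpose N H))))) ⟩
    N * (n′ * (a₀ * a₀)) + (∑≢ N H + ∑≢ N H + ∑≢ N Hₘₘ)
      ≡⟨ cong (λ h → N * (n′ * (a₀ * a₀)) + (h + ∑≢ N Hₘₘ)) (cong (_+_ (∑≢ N H)) (≡.sym (ℕₚ.+-identityʳ _))) ⟩
    N * (n′ * (a₀ * a₀)) + (2 * ∑≢ N H + ∑≢ N Hₘₘ) ∎
    where open ≡.≡-Reasoning

  NonTorsion : Fin N → ℕ
  NonTorsion q = 𝟙 (¬? (((2 * m) · s q) ≟ ε))

  Cᶜ : ℕ
  Cᶜ = ∑ (allFin N) NonTorsion

  C+Cᶜ≡N : C + Cᶜ ≡ N
  C+Cᶜ≡N = begin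
    C + Cᶜ                                     ≡⟨ ≡.sym (∑-+ (allFin N) Torsion NonTorsion) ⟩
    ∑[ q ∈ allFin N ] (Torsion q + NonTorsion q) ≡⟨ ∑-cong (allFin N) (λ q _ → 𝟙+𝟙¬ (((2 * m) · s q) ≟ ε)) ⟩
    ∑[ q ∈ allFin N ] 1                          ≡⟨ ∑-const (allFin N) 1 ⟩
    length (allFin N) * 1                        ≡⟨ ℕₚ.*-identityʳ _ ⟩
    length (allFin N)                            ≡⟨ length-tabulate {n = N} (λ i → i) ⟩
    N                                            ∎
    where open ≡.≡-Reasoning

  H-torsion : ∀ {p} q → (2 * m) · s p ≈ ε → H p q ≤ a₀
  H-torsion {p} q 2mx≈ε = begin
    H₁ p q + H₂ p q
      ≤⟨ ℕₚ.+-mono-≤ (∑-mono A₀ λ β β∈ → ℕₚ.≤-trans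
                        (∑-mono A λ γ γ∈ → 𝟙-mono (balanced? p q β γ) (γ ℤ.≟ ℤ.- β) (torsion-balanced 2mx≈ε β∈ γ∈))
                        (∑-𝟙-≟≤1 ℤ._≟_ A-unique (ℤ.- β)))
                     (ℕₚ.≤-reflexive (∑-zero A₀ λ γ γ∈ →
                        𝟙-no (balanced? p q (+ m) γ) (torsion-not-balanced-m 2mx≈ε γ∈))) ⟩
    ∑[ β ∈ A₀ ] 1 + 0
      ≡⟨ ≡.trans (ℕₚ.+-identityʳ _) ∑-A₀-1 ⟩
    a₀ ∎
    where open ℕₚ.≤-Reasoning

  H≤1+a₀ : ∀ p q → H p q ≤ 1 + a₀
  H≤1+a₀ p q = begin
    H₁ p q + H₂ p q
      ≤⟨ ℕₚ.+-mono-≤ (∑-mono A₀ λ β _ → ∑-𝟙≤1 (balanced? p q β) A-unique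
                                         (λ _ _ γ∈ γ′∈ → balanced-unique {p} {q} {β} γ∈ γ′∈))
                     (∑-𝟙≤1 (balanced? p q (+ m)) A₀-unique
                       (λ _ _ γ∈ γ′∈ → balanced-unique {p} {q} {+ m} (A₀⊆A γ∈) (A₀⊆A γ′∈))) ⟩
    ∑[ β ∈ A₀ ] 1 + 1
      ≡⟨ ≡.trans (cong (_+ 1) ∑-A₀-1) (ℕₚ.+-comm a₀ 1) ⟩
    1 + a₀ ∎
    where open ℕₚ.≤-Reasoning

  H-witness : ∀ p q → H p q ≢ 0 → ∃[ β ] ∃[ γ ] BalancedPair β γ × Balanced p q β γ
  H-witness p q H≢0 with H₁ p q ℕ.≟ 0
  ... | no H₁≢0 with ∑-nonzero A₀ H₁≢0
  ...   | β , β∈ , ∑≢0 with ∑-nonzero A ∑≢0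
  ...     | γ , γ∈ , nz = β , γ , inj₁ (β∈ , γ∈) , 𝟙≢0⇒ (balanced? p q β γ) nz
  H-witness p q H≢0 | yes H₁≡0 with ∑-nonzero A₀ (λ H₂≡0 → H≢0 (cong₂ _+_ H₁≡0 H₂≡0))
  ...   | γ , γ∈ , nz = + m , γ , inj₂ (refl , γ∈) , 𝟙≢0⇒ (balanced? p q (+ m) γ) nz

  H-row : ∀ p → ∑[ q ∈ allFin N ] [ p ≢ q ] * H p q ≤ Torsion p * (n′ * a₀) + NonTorsion p * (1 + a₀)
  H-row p with ((2 * m) · s p) ≟ ε
  ... | yes 2mx≈ε = begin
    ∑[ q ∈ allFin N ] [ p ≢ q ] * H p q  ≤⟨ ∑-mono (allFin N) (λ q _ → ℕₚ.*-monoʳ-≤ [ p ≢ q ] (H-torsion q 2mx≈ε)) ⟩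
    ∑[ q ∈ allFin N ] [ p ≢ q ] * a₀     ≡⟨ ∑-others-const p a₀ ⟩
    n′ * a₀                              ≡⟨ ≡.sym (≡.trans (ℕₚ.+-identityʳ _) (ℕₚ.*-identityˡ _)) ⟩
    1 * (n′ * a₀) + 0                    ∎
    where open ℕₚ.≤-Reasoning
  ... | no 2mx≉ε = ℕₚ.≤-trans (∑-atMostOne (1 + a₀) (Uniqueₚ.allFin⁺ N) bounded at-most-one)
                              (ℕₚ.≤-reflexive (≡.sym (ℕₚ.+-identityʳ _)))
    where
    bounded : ∀ q → q ∈ allFin N → [ p ≢ q ] * H p q ≤ 1 + a₀
    bounded q _ = ℕₚ.≤-trans (ℕₚ.*-monoˡ-≤ (H p q) (𝟙≤1 (¬? (p Fin.≟ q))))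
                             (ℕₚ.≤-trans (ℕₚ.≤-reflexive (ℕₚ.*-identityˡ _)) (H≤1+a₀ p q))
    witness : ∀ q → [ p ≢ q ] * H p q ≢ 0 → ∃[ β ] ∃[ γ ] BalancedPair β γ × Balanced p q β γ
    witness q nz = H-witness p q λ { H≡0 → nz (≡.trans (cong (_*_ [ p ≢ q ]) H≡0) (ℕₚ.*-zeroʳ [ p ≢ q ])) }
    at-most-one : ∀ q q′ → q ∈ allFin N → q′ ∈ allFin N → [ p ≢ q ] * H p q ≢ 0 → [ p ≢ q′ ] * H p q′ ≢ 0 → q ≡ q′
    at-most-one q q′ _ _ nz nz′ with witness q nz | witness q′ nz′
    ... | _ , _ , bp , bal | _ , _ , bp′ , bal′ =
      decidable-stable (q Fin.≟ q′) λ q≢q′ → balanced-exclusive 2mx≉ε q≢q′ bp bp′ bal bal′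

  ∑≢H≤ : ∑≢ N H ≤ C * (n′ * a₀) + Cᶜ * (1 + a₀)
  ∑≢H≤ = ℕₚ.≤-trans (∑-mono (allFin N) (λ p _ → H-row p)) (ℕₚ.≤-reflexive
    (≡.trans (∑-+ (allFin N) (λ p → Torsion p * (n′ * a₀)) (λ p → NonTorsion p * (1 + a₀)))
             (cong₂ _+_ (∑-*ʳ (allFin N) Torsion (n′ * a₀)) (∑-*ʳ (allFin N) NonTorsion (1 + a₀)))))

  Hₘₘ≤ : ∀ p q → Hₘₘ p q ≤ Torsion p * Torsion q + NonTorsion p * NonTorsion q
  Hₘₘ≤ p q with balanced? p q (+ m) (+ m)
  ... | no  _   = z≤n
  ... | yes bal with ((2 * m) · s p) ≟ ε | ((2 * m) · s q) ≟ ε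
  ...   | yes _    | yes _    = s≤s z≤n
  ...   | no  _    | no  _    = s≤s z≤n
  ...   | yes tp   | no  ¬tq  = ⊥-elim (¬tq (≈-trans (≈-sym (balanced-m-m bal)) tp))
  ...   | no  ¬tp  | yes tq   = ⊥-elim (¬tp (≈-trans (balanced-m-m bal) tq))

  ∑≢Hₘₘ≤ : ∑≢ N Hₘₘ + C + Cᶜ ≤ C * C + Cᶜ * Cᶜ
  ∑≢Hₘₘ≤ = begin
    ∑≢ N Hₘₘ + C + Cᶜ
      ≤⟨ ℕₚ.+-monoˡ-≤ Cᶜ (ℕₚ.+-monoˡ-≤ C (∑-mono (allFin N) λ p _ → ∑-mono (allFin N) λ q _ →
           ℕₚ.*-monoʳ-≤ [ p ≢ q ] (Hₘₘ≤ p q))) ⟩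
    ∑≢ N (λ p q → Torsion p * Torsion q + NonTorsion p * NonTorsion q) + C + Cᶜ
      ≡⟨ cong (λ t → t + C + Cᶜ) (∑≢-+ N (λ p q → Torsion p * Torsion q) (λ p q → NonTorsion p * NonTorsion q)) ⟩
    ∑≢ N (λ p q → Torsion p * Torsion q) + ∑≢ N (λ p q → NonTorsion p * NonTorsion q) + C + Cᶜ
      ≡⟨ shuffle (∑≢ N (λ p q → Torsion p * Torsion q)) _ C Cᶜ ⟩
    (∑≢ N (λ p q → Torsion p * Torsion q) + C) + (∑≢ N (λ p q → NonTorsion p * NonTorsion q) + Cᶜ)
      ≡⟨ cong₂ _+_ (∑≢-square N Torsion (λ p → 𝟙*𝟙 (((2 * m) · s p) ≟ ε)))
                   (∑≢-square N NonTorsion (λ p → 𝟙*𝟙 (¬? (((2 * m) · s p) ≟ ε)))) ⟩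
    C * C + Cᶜ * Cᶜ ∎
    where
    open ℕₚ.≤-Reasoning
    shuffle : ∀ a b c d → a + b + c + d ≡ (a + c) + (b + d)
    shuffle = ℕ-Solver.solve-∀

  module _ (no-order-2m : mOrd (2 * m) ≡ 0) where

    ¬HasOrder-2m : ∀ g → ¬ HasOrder (2 * m) g
    ¬HasOrder-2m g ord = ℕₚ.<-irrefl (≡.sym no-order-2m) (HasOrder⇒mOrd-pos (2 * m) g ord)

    C≡0 : C ≡ 0
    C≡0 = ∑-zero (allFin N) λ p _ → 𝟙-no (((2 * m) · s p) ≟ ε) (¬HasOrder-2m (s p) ∘ hasOrder-2m p)

    ∑≢Hₘₘ≡0 : ∑≢ N Hₘₘ ≡ 0
    ∑≢Hₘₘ≡0 = ∑-zero (allFin N) λ p _ → ∑-zero (allFin N) λ q _ → off-diagonal p q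
      where
      off-diagonal : ∀ p q → [ p ≢ q ] * Hₘₘ p q ≡ 0
      off-diagonal p q with p Fin.≟ q
      ... | yes _   = refl
      ... | no  p≢q = ≡.trans (cong (1 *_) (𝟙-no (balanced? p q (+ m) (+ m))
                        (¬HasOrder-2m _ ∘ hasOrder-2m-difference p≢q ∘ balanced-m-m))) refl

  C≤m₂ : C ≤ mOrd 2
  C≤m₂ = begin
    ∑[ p ∈ allFin N ] Torsion p          ≤⟨ ∑-mono (allFin N) (λ p _ → 𝟙-mono (((2 * m) · s p) ≟ ε) _ (order-2 p)) ⟩
    ∑[ p ∈ allFin N ] f (φ p)            ≡⟨ ≡.sym (∑-map φ (allFin N) f) ⟩
    ∑ (map φ (allFin N)) f               ≤⟨ ∑-⊆ f (Uniqueₚ.map⁺ φ-injective (Uniqueₚ.allFin⁺ N))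
                                                   (λ {i} _ → ∈-allFin i) ⟩
    ∑ (allFin size) f                    ≡⟨ ≡.sym (countFin≡∑ size _ _) ⟩
    mOrd 2                               ∎
    where
    open ℕₚ.≤-Reasoning
    f : Fin size → ℕ
    f i = 𝟙 (hasOrder? 2 (enum i))
    φ : Fin N → Fin size
    φ p = proj₁ (enum-surj (m · s p))
    φ-injective : ∀ {p q} → φ p ≡ φ q → p ≡ q
    φ-injective {p} {q} φp≡φq = m·-injective (≈-trans (≈-sym (proj₂ (enum-surj (m · s p))))
      (≈-trans (reflexive (cong enum φp≡φq)) (proj₂ (enum-surj (m · s q)))))
    order-2 : ∀ p → (2 * m) · s p ≈ ε → HasOrder 2 (enum (φ p))
    order-2 p 2mx≈ε = HasOrder-resp 2 (≈-sym (proj₂ (enum-surj (m · s p)))) (hasOrder-2-half p 2mx≈ε)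

  double-M2≤ : 2 * M2 N m s ≤ 2 * (N * a₀ + C) + (N * (n′ * (a₀ * a₀)) + (2 * ∑≢ N H + ∑≢ N Hₘₘ))
  double-M2≤ = ℕₚ.≤-trans double-M2≤Quadruples (ℕₚ.≤-trans Quadruples≤∑ClassPair
           (ℕₚ.≤-trans ∑ClassPair≤ (ℕₚ.≤-reflexive (cong (_+_ (2 * (N * a₀ + C))) ∑≢W))))

  master-bound : 2 * M2 N m s + C + Cᶜ ≤
                 2 * (N * a₀ + C) + N * (n′ * (a₀ * a₀)) + 2 * (C * (n′ * a₀) + Cᶜ * (1 + a₀)) + C * C + Cᶜ * Cᶜ
  master-bound = begin
    2 * M2 N m s + C + Cᶜ
      ≤⟨ ℕₚ.+-monoˡ-≤ Cᶜ (ℕₚ.+-monoˡ-≤ C double-M2≤) ⟩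
    2 * (N * a₀ + C) + (N * (n′ * (a₀ * a₀)) + (2 * ∑≢ N H + ∑≢ N Hₘₘ)) + C + Cᶜ
      ≡⟨ regroup (2 * (N * a₀ + C)) (N * (n′ * (a₀ * a₀))) (∑≢ N H) (∑≢ N Hₘₘ) C Cᶜ ⟩
    2 * (N * a₀ + C) + N * (n′ * (a₀ * a₀)) + 2 * ∑≢ N H + (∑≢ N Hₘₘ + C + Cᶜ)
      ≤⟨ ℕₚ.+-mono-≤ (ℕₚ.+-monoʳ-≤ (2 * (N * a₀ + C) + N * (n′ * (a₀ * a₀))) (ℕₚ.*-monoʳ-≤ 2 ∑≢H≤)) ∑≢Hₘₘ≤ ⟩
    2 * (N * a₀ + C) + N * (n′ * (a₀ * a₀)) + 2 * (C * (n′ * a₀) + Cᶜ * (1 + a₀)) + (C * C + Cᶜ * Cᶜ)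
      ≡⟨ ≡.sym (ℕₚ.+-assoc _ (C * C) (Cᶜ * Cᶜ)) ⟩
    2 * (N * a₀ + C) + N * (n′ * (a₀ * a₀)) + 2 * (C * (n′ * a₀) + Cᶜ * (1 + a₀)) + C * C + Cᶜ * Cᶜ ∎
    where
    open ℕₚ.≤-Reasoning
    regroup : ∀ a b h d c k → a + (b + (2 * h + d)) + c + k ≡ a + b + 2 * h + (d + c + k)
    regroup = ℕ-Solver.solve-∀

  master-bound-without-order-2m : mOrd (2 * m) ≡ 0 →
                                  2 * M2 N m s ≤ 2 * (N * a₀) + N * (n′ * (a₀ * a₀)) + 2 * (N * (1 + a₀))
  master-bound-without-order-2m no-order-2m = begin
    2 * M2 N m s
      ≤⟨ double-M2≤ ⟩
    2 * (N * a₀ + C) + (N * (n′ * (a₀ * a₀)) + (2 * ∑≢ N H + ∑≢ N Hₘₘ))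
      ≡⟨ cong₂ (λ c d → 2 * (N * a₀ + c) + (N * (n′ * (a₀ * a₀)) + (2 * ∑≢ N H + d)))
               (C≡0 no-order-2m) (∑≢Hₘₘ≡0 no-order-2m) ⟩
    2 * (N * a₀ + 0) + (N * (n′ * (a₀ * a₀)) + (2 * ∑≢ N H + 0))
      ≤⟨ ℕₚ.+-monoʳ-≤ (2 * (N * a₀ + 0)) (ℕₚ.+-monoʳ-≤ (N * (n′ * (a₀ * a₀)))
           (ℕₚ.+-monoˡ-≤ 0 (ℕₚ.*-monoʳ-≤ 2 ∑≢H≤N))) ⟩
    2 * (N * a₀ + 0) + (N * (n′ * (a₀ * a₀)) + (2 * (N * (1 + a₀)) + 0))
      ≡⟨ drop-zeros (N * a₀) (N * (n′ * (a₀ * a₀))) (N * (1 + a₀)) ⟩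
    2 * (N * a₀) + N * (n′ * (a₀ * a₀)) + 2 * (N * (1 + a₀)) ∎
    where
    open ℕₚ.≤-Reasoning
    drop-zeros : ∀ a b c → 2 * (a + 0) + (b + (2 * c + 0)) ≡ 2 * a + b + 2 * c
    drop-zeros = ℕ-Solver.solve-∀
    Cᶜ≡N : Cᶜ ≡ N
    Cᶜ≡N = ≡.trans (cong (_+ Cᶜ) (≡.sym (C≡0 no-order-2m))) C+Cᶜ≡N
    ∑≢H≤N : ∑≢ N H ≤ N * (1 + a₀)
    ∑≢H≤N = ℕₚ.≤-trans ∑≢H≤ (ℕₚ.≤-reflexive (cong₂ (λ c k → c * (n′ * a₀) + k * (1 + a₀)) (C≡0 no-order-2m) Cᶜ≡N))

module Conclusion {c ℓ} (G : FiniteAbelianGroup c ℓ) (k n′ : ℕ)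
                  (s : Fin (suc n′) → FiniteAbelianGroup.Carrier G)
                  (D : FAG.Diamond G -[1+ k ] (+ suc (suc k)) 2 s) where

  open FAG G using (Ccount; M2; mOrd)
  open Coefficients k using (m)
  open Decoding G k n′ using (N)
  open Counting G k n′ s D
  open Casting
  open Arithmetic
  open import Data.Integer using () renaming (_+_ to _+ℤ_; _-_ to _-ℤ_; _*_ to _*ℤ_; _≤_ to _≤ℤ_)

  N′ A′ : Poly
  N′ = ⌜ 1 ⌝ ⊕ ⌜ n′ ⌝
  A′ = (⌜ 1 ⌝ ⊕ ⌜ k ⌝) ⊕ (⌜ 1 ⌝ ⊕ ⌜ k ⌝)

  bound-with-order-2m : + 2 *ℤ + M2 N m s ≤ℤ Bound₁ (+ m) (+ N) (+ Ccount N m s) (+ mOrd 2)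
  bound-with-order-2m = subst (λ c → + 2 *ℤ + M2 N m s ≤ℤ Bound₁ (+ m) (+ N) (+ c) (+ mOrd 2))
    (≡.sym (countFin≡∑ N _ _))
    (bound₁ (+ k) (+ n′) (+ C) (+ Cᶜ) (+ 2 *ℤ + M2 N m s) (+ mOrd 2) (0≤+ k) (0≤+ Cᶜ) n′≡C+Cᶜ-1 (ℤ.+≤+ C≤m₂)
      (cast-≤ (⌜ 2 ⌝ ⊗ ⌜ M2 N m s ⌝ ⊕ ⌜ C ⌝ ⊕ ⌜ Cᶜ ⌝)
              (⌜ 2 ⌝ ⊗ (N′ ⊗ A′ ⊕ ⌜ C ⌝) ⊕ N′ ⊗ (⌜ n′ ⌝ ⊗ (A′ ⊗ A′))
                ⊕ ⌜ 2 ⌝ ⊗ (⌜ C ⌝ ⊗ (⌜ n′ ⌝ ⊗ A′) ⊕ ⌜ Cᶜ ⌝ ⊗ (⌜ 1 ⌝ ⊕ A′)) ⊕ ⌜ C ⌝ ⊗ ⌜ C ⌝ ⊕ ⌜ Cᶜ ⌝ ⊗ ⌜ Cᶜ ⌝)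
              master-bound))
    where
    n′≡C+Cᶜ-1 : + n′ ≡ + C +ℤ + Cᶜ -ℤ + 1
    n′≡C+Cᶜ-1 = ≡.sym (cong (_-ℤ + 1) (≡.trans (≡.sym (ℤₚ.pos-+ C Cᶜ)) (cong +_ C+Cᶜ≡N)))

  bound-without-order-2m : mOrd (2 * m) ≡ 0 → + M2 N m s ≤ℤ Bound₂ (+ m) (+ N) (+ mOrd 2)
  bound-without-order-2m no-order-2m =
    bound₂ (+ k) (+ n′) (+ M2 N m s) (+ mOrd 2) (0≤+ k) (0≤+ n′) (0≤+ (mOrd 2))
      (cast-≤ (⌜ 2 ⌝ ⊗ ⌜ M2 N m s ⌝)
              (⌜ 2 ⌝ ⊗ (N′ ⊗ A′) ⊕ N′ ⊗ (⌜ n′ ⌝ ⊗ (A′ ⊗ A′)) ⊕ ⌜ 2 ⌝ ⊗ (N′ ⊗ (⌜ 1 ⌝ ⊕ A′)))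
              (master-bound-without-order-2m no-order-2m))

import Data.Nat
open import Data.Integer using (+_) renaming (_+_ to _+ℤ_; _-_ to _-ℤ_; _*_ to _*ℤ_; _≤_ to _≤ℤ_)

lemma6 : ∀ {c ℓ} (G : FiniteAbelianGroup c ℓ) →
         let open FiniteAbelianGroup G using (Carrier) in
         let open FAG G in
         (m n : ℕ) → 2 ≤ m → 1 ≤ n → (s : Fin n → Carrier) →
         Diamond (+ 1 -ℤ + m) (+ m) 2 s →
         let M = + m
             N = + n
             C = + Ccount n m s
             K = + M2 n m s
             m₂ = + mOrd 2
         in
         (0 < mOrd (2 Data.Nat.* m) →
            + 2 *ℤ K ≤ℤ
              (+ 4 *ℤ M *ℤ M -ℤ + 8 *ℤ M +ℤ + 5) *ℤ N *ℤ N
              +ℤ (+ 8 *ℤ M -ℤ + 9) *ℤ N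
              +ℤ + 2 *ℤ C *ℤ C
              +ℤ + 2 *ℤ (+ 2 *ℤ M *ℤ N -ℤ + 3 *ℤ N -ℤ + 2 *ℤ M *ℤ M -ℤ + 2 *ℤ M +ℤ + 6) *ℤ C
              +ℤ + 2 *ℤ (+ 2 *ℤ M -ℤ + 3) *ℤ m₂)
         ×
         (mOrd (2 Data.Nat.* m) ≡ 0 →
            K ≤ℤ
              (+ 2 *ℤ M *ℤ M -ℤ + 4 *ℤ M +ℤ + 2) *ℤ N *ℤ N
              +ℤ (+ 4 *ℤ M -ℤ + 4) *ℤ N
              +ℤ (+ 2 *ℤ M -ℤ + 3) *ℤ m₂)
-- The first bound holds whether or not G has an element of order 2m.
lemma6 G (suc (suc k)) (suc n′) (s≤s (s≤s z≤n)) (s≤s z≤n) s D = (λ _ → bound-with-order-2m) , bound-without-order-2m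
  where open Conclusion G k n′ s D
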